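{- With the conventions $p_{K_1}(x)=1$ and $p_{K_2}(x)=x$: (i) for the disjoint union $G\,\dot\cup\,H$ of finite simple graphs $G$ and $H$ we have $p_{G\,\dot\cup\, H}(x)=p_G(x)p_H(x)$; (ii) for every finite simple graph $G$ with at least one edge and with no isolated edges (no connected component isomorphic to $K_2$) we have \[ p_G(x)=\frac{1}{|E(G)|}\sum_{e\in E(G)}p_{G-e}(x), \] where $G-e$ is the graph obtained from $G$ by deleting the edge $e$ (keeping all vertices).
   Context: Forest building process: for a finite simple graph $G$ with $m$ edges, choose an ordering $e_1,\dots,e_m$ of $E(G)$ uniformly at random; start with no edges on $V(G)$ and for $j=1,\dots,m$ keep $e_j$ if and only if $e_j$ is incident to a vertex not incident to any $e_i$ with $i<j$. $P(G,k)$ is the probability that the resulting forest has exactly $k$ connected components, where isolated vertices of $G$ do not contribute to the component count (so only components containing at least one edge are counted; in particular a graph with no edges, such as $K_1$, gives $0$ components with probability $1$). $p_G(x)=\sum_kP(G,k)x^k$. -}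

module Defs where

open import Data.Bool using (Bool; true; false; _∧_; _∨_; not; if_then_else_)
open import Data.Nat as ℕ using (ℕ; zero; suc; _∸_)
open import Data.Fin as Fin using (Fin; _↑ˡ_; _↑ʳ_)
open import Data.Fin.Properties using () renaming (_≟_ to _≟ᶠ_)
open import Data.Product using (_×_; _,_; proj₁; proj₂)
open import Data.Product.Properties using (≡-dec)
open import Data.List using (List; []; _∷_; map; concatMap; filter; length; allFin; foldr; _++_; upTo)
open import Data.List.Relation.Unary.All using (All)
open import Data.List.Relation.Unary.Unique.Propositional using (Unique)
open import Data.Bool.ListAction using (any)
open import Data.Integer using (+_)
open import Data.Rational using (ℚ; _/_; 0ℚ; _+_; _*_)
open import Relation.Nullary using (¬?)
open import Relation.Nullary.Decidable using (⌊_⌋)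

-- A finite simple graph: vertex set Fin n, edge list of pairs (u , v) with u < v
-- (each unordered edge {u,v} stored once, canonically oriented, no loops) and no repeats.
Edge : ℕ → Set
Edge n = Fin n × Fin n

Simple : (n : ℕ) → List (Edge n) → Set
Simple n es = All (λ e → proj₁ e Fin.< proj₂ e) es × Unique es

eqV : ∀ {n} → Fin n → Fin n → Bool
eqV u v = ⌊ u ≟ᶠ v ⌋

eqE : ∀ {n} → Edge n → Edge n → Bool
eqE e f = ⌊ ≡-dec _≟ᶠ_ _≟ᶠ_ e f ⌋

memV : ∀ {n} → Fin n → List (Fin n) → Bool
memV v vs = any (eqV v) vs

insertions : {A : Set} → A → List A → List (List A)
insertions x [] = (x ∷ []) ∷ []
insertions x (y ∷ ys) = (x ∷ y ∷ ys) ∷ map (y ∷_) (insertions x ys)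

orderings : {A : Set} → List A → List (List A)
orderings [] = [] ∷ []
orderings (x ∷ xs) = concatMap (insertions x) (orderings xs)

-- forest building process: `seen` = vertices incident to some earlier edge e_i (i < j);
-- e_j is kept iff one of its endpoints is not in `seen`.
buildFrom : ∀ {n} → List (Fin n) → List (Edge n) → List (Edge n)
buildFrom seen [] = []
buildFrom seen ((u , v) ∷ rest) =
  if memV u seen ∧ memV v seen
  then buildFrom (u ∷ v ∷ seen) rest
  else (u , v) ∷ buildFrom (u ∷ v ∷ seen) rest

buildForest : ∀ {n} → List (Edge n) → List (Edge n)
buildForest = buildFrom []

adj : ∀ {n} → List (Edge n) → Fin n → Fin n → Bool
adj F u v = any (λ e → (eqV (proj₁ e) u ∧ eqV (proj₂ e) v) ∨ (eqV (proj₁ e) v ∧ eqV (proj₂ e) u)) F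

reachIn : ∀ {n} → List (Edge n) → ℕ → Fin n → Fin n → Bool
reachIn {n} F zero u v = eqV u v
reachIn {n} F (suc s) u v = reachIn F s u v ∨ any (λ w → reachIn F s u w ∧ adj F w v) (allFin n)

connected : ∀ {n} → List (Edge n) → Fin n → Fin n → Bool
connected {n} F u v = reachIn F n u v

nonIsolated : ∀ {n} → List (Edge n) → Fin n → Bool
nonIsolated F v = any (λ e → eqV (proj₁ e) v ∨ eqV (proj₂ e) v) F

-- a component is counted once, via its least vertex
isLeastInComponent : ∀ {n} → List (Edge n) → Fin n → Bool
isLeastInComponent {n} F v = not (any (λ w → ⌊ w Fin.<? v ⌋ ∧ connected F v w) (allFin n))

componentCount : ∀ {n} → List (Edge n) → ℕ
componentCount {n} F = length (filter (λ v → nonIsolated F v ∧ isLeastInComponent F v ≟b true) (allFin n))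
  where
  open import Data.Bool.Properties using () renaming (_≟_ to _≟b_)

-- rational a / d (d = 0 never occurs below since orderings is nonempty)
divℕ : ℕ → ℕ → ℚ
divℕ a zero = 0ℚ
divℕ a (suc d) = (+ a) / suc d

P : (n : ℕ) → List (Edge n) → ℕ → ℚ
P n es k =
  divℕ (length (filter (λ σ → componentCount (buildForest σ) ℕ.≟ k) (orderings es)))
       (length (orderings es))

-- coefficients of p_G(x) = Σ_k P(G,k) x^k
pCoeff : (n : ℕ) → List (Edge n) → ℕ → ℚ
pCoeff = P

sumℚ : List ℚ → ℚ
sumℚ = foldr _+_ 0ℚ

convolve : (ℕ → ℚ) → (ℕ → ℚ) → ℕ → ℚ
convolve f g k = sumℚ (map (λ i → f i * g (k ∸ i)) (upTo (suc k)))

-- average of a list (0 for the empty list; only used for nonempty lists)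
average : List ℚ → ℚ
average [] = 0ℚ
average (x ∷ xs) = divℕ 1 (suc (length xs)) * sumℚ (x ∷ xs)

disjointUnion : ∀ {n m} → List (Edge n) → List (Edge m) → List (Edge (n ℕ.+ m))
disjointUnion {n} {m} es fs =
  map (λ e → (proj₁ e ↑ˡ m , proj₂ e ↑ˡ m)) es ++ map (λ e → (n ↑ʳ proj₁ e , n ↑ʳ proj₂ e)) fs

deleteEdge : ∀ {n} → List (Edge n) → Edge n → List (Edge n)
deleteEdge es e = filter (λ f → ¬? (≡-dec _≟ᶠ_ _≟ᶠ_ f e)) es

degree : ∀ {n} → List (Edge n) → Fin n → ℕ
degree es v = length (filter (λ e → (eqV (proj₁ e) v ∨ eqV (proj₂ e) v) ≟b true) es)
  where
  open import Data.Bool.Properties using () renaming (_≟_ to _≟b_)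

-- no isolated edge: no component isomorphic to K₂, i.e. no edge {u,v} with
-- both endpoints of degree 1
NoIsolatedEdge : (n : ℕ) → List (Edge n) → Set
NoIsolatedEdge n es = All (λ e → ¬ (degree es (proj₁ e) ≡ 1 × degree es (proj₂ e) ≡ 1)) es
  where
  open import Relation.Nullary using (¬_)
  open import Relation.Binary.PropositionalEquality using (_≡_)

module Submission where

-- Look at the last edge e of a uniformly random ordering of E(G). The earlier edges form a
-- uniformly random ordering of G − e, they build the forest of G − e, and that forest covers
-- exactly the vertices covered by G − e. So e is dropped if both endpoints are covered, joins an
-- uncovered endpoint to an existing component if exactly one is, and starts a new component iff
-- neither is, i.e. iff e is an isolated edge of G. Averaging over e,
--   p_G(x) = (1/|E(G)|) Σ_e x^[e isolated] p_{G−e}(x),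
-- which is (ii) when G has no isolated edges. For (i) induct on |E(G)| + |E(H)|: an edge of G is
-- isolated in G ∪̇ H iff it is isolated in G and deleting it only changes G, so by induction the
-- summands for edges of G are x^[e isolated] p_{G−e} p_H; summing with the recurrences for G and
-- for H gives (|E(G)| + |E(H)|) p_G p_H.

open import Defs
open import Data.Bool using (Bool; true; false; _∧_; _∨_; not; if_then_else_)
open import Data.Bool.ListAction using (any)
import Data.Bool.Properties as BoolP
open import Data.Empty using (⊥; ⊥-elim)
open import Data.Fin as Fin using (Fin; toℕ; _↑ˡ_; _↑ʳ_)
import Data.Fin.Properties as FinP
open import Data.List using (List; []; _∷_; map; concatMap; filter; length; _++_; _∷ʳ_; allFin; tabulate; applyUpTo; upTo)
open import Data.List.Properties using (++-identityʳ; length-++; length-map; map-cong-local; filter-++)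
open import Data.List.Membership.Propositional using (_∈_; _∉_)
open import Data.List.Membership.Propositional.Properties using (∈-concatMap⁻; ∈-map⁻; ∈-allFin)
open import Data.List.Relation.Unary.Any using (Any; here; there)
open import Data.List.Relation.Unary.All as All using (All; _∷_)
import Data.List.Relation.Unary.All.Properties as AllP
open import Data.List.Relation.Unary.AllPairs using (_∷_)
open import Data.List.Relation.Unary.Unique.Propositional using (Unique)
import Data.List.Relation.Unary.Unique.Propositional.Properties as UniqueP
open import Data.List.Relation.Binary.Permutation.Propositional using (_↭_; ↭-refl; ↭-sym; ↭-trans; prep; swap)
open import Data.List.Relation.Binary.Permutation.Propositional.Properties using (↭-length; ∈-resp-↭)
open import Data.Nat as ℕ using (ℕ; zero; suc; _+_; _*_; _∸_; _!; z≤n; s≤s)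
import Data.Nat.Properties as ℕP
open import Data.Nat.Tactic.RingSolver using (solve-∀)
import Data.Integer as ℤ
import Data.Integer.Properties as ℤP
open import Data.Rational as ℚ using (ℚ; 0ℚ; 1ℚ)
import Data.Rational.Properties as ℚP
open import Algebra.Bundles using (CommutativeMonoid)
open import Algebra.Properties.CommutativeSemigroup (CommutativeMonoid.commutativeSemigroup ℚP.+-0-commutativeMonoid)
  using () renaming (interchange to +-interchange)
open import Algebra.Properties.CommutativeSemigroup (CommutativeMonoid.commutativeSemigroup ℚP.*-1-commutativeMonoid)
  using () renaming (x∙yz≈y∙xz to *-left-comm)
open import Data.Rational.Unnormalised using (mkℚᵘ; *≡*)
import Data.Rational.Unnormalised.Properties as ℚᵘP
open import Data.Product.Properties using (≡-dec; ×-≡,≡→≡)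
open import Data.Product using (_×_; _,_; proj₁; proj₂; ∃; Σ)
open import Data.Sum using (_⊎_; inj₁; inj₂)
open import Function using (_∘_)
open import Relation.Binary.Definitions using (DecidableEquality; Tri; tri<; tri≈; tri>)
open import Relation.Binary.PropositionalEquality
open import Relation.Nullary using (¬_; Dec; yes; no; ¬?; contradiction)
open import Relation.Nullary.Decidable using (⌊_⌋)

[_]ᵇ : Bool → ℕ
[ b ]ᵇ = if b then 1 else 0

sumBy : {B : Set} → (B → ℕ) → List B → ℕ
sumBy f [] = 0
sumBy f (x ∷ xs) = f x + sumBy f xs

sumBy-cong : {B : Set} {f g : B → ℕ} (xs : List B) → (∀ x → x ∈ xs → f x ≡ g x) → sumBy f xs ≡ sumBy g xs
sumBy-cong [] h = refl
sumBy-cong (x ∷ xs) h = cong₂ _+_ (h x (here refl)) (sumBy-cong xs (λ y y∈ → h y (there y∈)))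

sumBy-++ : {B : Set} (f : B → ℕ) (xs ys : List B) → sumBy f (xs ++ ys) ≡ sumBy f xs + sumBy f ys
sumBy-++ f [] ys = refl
sumBy-++ f (x ∷ xs) ys = trans (cong (f x +_) (sumBy-++ f xs ys)) (sym (ℕP.+-assoc (f x) _ _))

sumBy-map : {B C : Set} (f : C → ℕ) (g : B → C) (xs : List B) → sumBy f (map g xs) ≡ sumBy (f ∘ g) xs
sumBy-map f g [] = refl
sumBy-map f g (x ∷ xs) = cong (f (g x) +_) (sumBy-map f g xs)

sumBy-+ : {B : Set} (f g : B → ℕ) (xs : List B) → sumBy (λ x → f x + g x) xs ≡ sumBy f xs + sumBy g xs
sumBy-+ f g [] = refl
sumBy-+ f g (x ∷ xs) rewrite sumBy-+ f g xs = interchange (f x) (g x) (sumBy f xs) (sumBy g xs)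
  where
  interchange : ∀ a b c d → a + b + (c + d) ≡ a + c + (b + d)
  interchange = solve-∀

sumBy-concatMap : {B C : Set} (f : C → ℕ) (g : B → List C) (xs : List B) →
  sumBy f (concatMap g xs) ≡ sumBy (sumBy f ∘ g) xs
sumBy-concatMap f g [] = refl
sumBy-concatMap f g (x ∷ xs) =
  trans (sumBy-++ f (g x) (concatMap g xs)) (cong (sumBy f (g x) +_) (sumBy-concatMap f g xs))

sumBy-const : {B : Set} (c : ℕ) (xs : List B) → sumBy (λ _ → c) xs ≡ length xs * c
sumBy-const c [] = refl
sumBy-const c (x ∷ xs) = cong (c +_) (sumBy-const c xs)

length-filter≡sumBy : {B : Set} {P : B → Set} (P? : ∀ x → Dec (P x)) (xs : List B) →
  length (filter P? xs) ≡ sumBy (λ x → [ ⌊ P? x ⌋ ]ᵇ) xs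
length-filter≡sumBy P? [] = refl
length-filter≡sumBy P? (x ∷ xs) with P? x
... | yes _ = cong suc (length-filter≡sumBy P? xs)
... | no _ = length-filter≡sumBy P? xs

module _ {A : Set} where

  length-insertions : (x : A) (σ : List A) → length (insertions x σ) ≡ suc (length σ)
  length-insertions x [] = refl
  length-insertions x (y ∷ σ) = cong suc (trans (length-map (y ∷_) (insertions x σ)) (length-insertions x σ))

  ∈-insertions⇒↭ : (x : A) (σ ρ : List A) → ρ ∈ insertions x σ → ρ ↭ x ∷ σ
  ∈-insertions⇒↭ x [] ρ (here refl) = ↭-refl
  ∈-insertions⇒↭ x (y ∷ σ) ρ (here refl) = ↭-refl
  ∈-insertions⇒↭ x (y ∷ σ) ρ (there ρ∈) with ∈-map⁻ (y ∷_) ρ∈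
  ... | ρ′ , ρ′∈ , refl = ↭-trans (prep y (∈-insertions⇒↭ x σ ρ′ ρ′∈)) (swap y x ↭-refl)

  ∈-orderings⇒↭ : (xs τ : List A) → τ ∈ orderings xs → τ ↭ xs
  ∈-orderings⇒↭ [] .[] (here refl) = ↭-refl
  ∈-orderings⇒↭ (x ∷ xs) τ τ∈ with ∈-concatMap⁻ (insertions x) {xs = orderings xs} τ∈
  ... | σ∈ = go (orderings xs) (∈-orderings⇒↭ xs) σ∈
    where
    go : ∀ L → (∀ σ → σ ∈ L → σ ↭ xs) → Any (λ σ → τ ∈ insertions x σ) L → τ ↭ x ∷ xs
    go (σ ∷ L) ↭xs (here τ∈) = ↭-trans (∈-insertions⇒↭ x σ τ τ∈) (prep x (↭xs σ (here refl)))
    go (σ ∷ L) ↭xs (there τ∈) = go L (λ σ′ σ′∈ → ↭xs σ′ (there σ′∈)) τ∈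

  sumBy-insertions-∷ʳ : (x y : A) (τ : List A) (f : List A → ℕ) →
    sumBy f (insertions x (τ ∷ʳ y)) ≡ sumBy (f ∘ (_∷ʳ y)) (insertions x τ) + f (τ ∷ʳ y ∷ʳ x)
  sumBy-insertions-∷ʳ x y [] f = rearrange (f (x ∷ y ∷ [])) (f (y ∷ x ∷ []))
    where
    rearrange : ∀ a b → a + (b + 0) ≡ (a + 0) + b
    rearrange = solve-∀
  sumBy-insertions-∷ʳ x y (z ∷ τ) f = begin
    f (x ∷ z ∷ τ ∷ʳ y) + sumBy f (map (z ∷_) (insertions x (τ ∷ʳ y)))
      ≡⟨ cong (f (x ∷ z ∷ τ ∷ʳ y) +_) (sumBy-map f (z ∷_) (insertions x (τ ∷ʳ y))) ⟩
    f (x ∷ z ∷ τ ∷ʳ y) + sumBy (f ∘ (z ∷_)) (insertions x (τ ∷ʳ y))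
      ≡⟨ cong (f (x ∷ z ∷ τ ∷ʳ y) +_) (sumBy-insertions-∷ʳ x y τ (f ∘ (z ∷_))) ⟩
    f (x ∷ z ∷ τ ∷ʳ y) + (sumBy (λ σ → f (z ∷ σ ∷ʳ y)) (insertions x τ) + f (z ∷ τ ∷ʳ y ∷ʳ x))
      ≡⟨ sym (ℕP.+-assoc (f (x ∷ z ∷ τ ∷ʳ y)) _ _) ⟩
    f (x ∷ z ∷ τ ∷ʳ y) + sumBy (λ σ → f (z ∷ σ ∷ʳ y)) (insertions x τ) + f (z ∷ τ ∷ʳ y ∷ʳ x)
      ≡⟨ cong (λ t → f (x ∷ z ∷ τ ∷ʳ y) + t + f (z ∷ τ ∷ʳ y ∷ʳ x))
              (sym (sumBy-map (f ∘ (_∷ʳ y)) (z ∷_) (insertions x τ))) ⟩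
    f (x ∷ z ∷ τ ∷ʳ y) + sumBy (f ∘ (_∷ʳ y)) (map (z ∷_) (insertions x τ)) + f (z ∷ τ ∷ʳ y ∷ʳ x)
      ∎
    where open ≡-Reasoning

  All≢⇒∉ : {x : A} {xs : List A} → All (λ y → ¬ x ≡ y) xs → x ∉ xs
  All≢⇒∉ (x≢y ∷ _) (here refl) = x≢y refl
  All≢⇒∉ (_ ∷ x≢ys) (there x∈) = All≢⇒∉ x≢ys x∈

  length-orderings : (xs : List A) → length (orderings xs) ≡ length xs !
  length-orderings [] = refl
  length-orderings (x ∷ xs) = begin
    length (concatMap (insertions x) (orderings xs))        ≡⟨ length≡sumBy-1 (concatMap (insertions x) (orderings xs)) ⟩
    sumBy (λ _ → 1) (concatMap (insertions x) (orderings xs)) ≡⟨ sumBy-concatMap (λ _ → 1) (insertions x) (orderings xs) ⟩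
    sumBy (sumBy (λ _ → 1) ∘ insertions x) (orderings xs)    ≡⟨ sumBy-cong (orderings xs) each ⟩
    sumBy (λ _ → suc (length xs)) (orderings xs)             ≡⟨ sumBy-const (suc (length xs)) (orderings xs) ⟩
    length (orderings xs) * suc (length xs)                  ≡⟨ cong (_* suc (length xs)) (length-orderings xs) ⟩
    length xs ! * suc (length xs)                            ≡⟨ ℕP.*-comm (length xs !) (suc (length xs)) ⟩
    suc (length xs) !                                        ∎
    where
    open ≡-Reasoning
    length≡sumBy-1 : (ys : List (List A)) → length ys ≡ sumBy (λ _ → 1) ys
    length≡sumBy-1 ys = trans (sym (ℕP.*-identityʳ (length ys))) (sym (sumBy-const 1 ys))
    each : ∀ σ → σ ∈ orderings xs → sumBy (λ _ → 1) (insertions x σ) ≡ suc (length xs)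
    each σ σ∈ = begin
      sumBy (λ _ → 1) (insertions x σ) ≡⟨ sym (length≡sumBy-1 (insertions x σ)) ⟩
      length (insertions x σ)          ≡⟨ length-insertions x σ ⟩
      suc (length σ)                   ≡⟨ cong suc (↭-length (∈-orderings⇒↭ xs σ σ∈)) ⟩
      suc (length xs)                  ∎

module Removal {A : Set} (_≟_ : DecidableEquality A) where

  remove : List A → A → List A
  remove xs e = filter (λ f → ¬? (f ≟ e)) xs

  remove-≢ : ∀ {x e} xs → ¬ x ≡ e → remove (x ∷ xs) e ≡ x ∷ remove xs e
  remove-≢ {x} {e} xs x≢e with x ≟ e
  ... | yes x≡e = contradiction x≡e x≢e
  ... | no _ = refl

  remove-head : ∀ {e} xs → remove (e ∷ xs) e ≡ remove xs e
  remove-head {e} xs with e ≟ e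
  ... | yes _ = refl
  ... | no e≢e = contradiction refl e≢e

  remove-∉ : ∀ {e} xs → e ∉ xs → remove xs e ≡ xs
  remove-∉ [] _ = refl
  remove-∉ (x ∷ xs) e∉ =
    trans (remove-≢ xs (λ x≡e → e∉ (here (sym x≡e)))) (cong (x ∷_) (remove-∉ xs (e∉ ∘ there)))

  unique-remove : ∀ {e} xs → Unique xs → Unique (remove xs e)
  unique-remove {e} xs = UniqueP.filter⁺ (λ f → ¬? (f ≟ e))

  length-filter-remove : {P : A → Set} (P? : ∀ a → Dec (P a)) {e : A} (xs : List A) → Unique xs → e ∈ xs →
    length (filter P? xs) ≡ length (filter P? (remove xs e)) + [ ⌊ P? e ⌋ ]ᵇ
  length-filter-remove P? {e} (x ∷ xs) (x≢ ∷ u) (here refl)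
    rewrite remove-head {e} xs | remove-∉ xs (All≢⇒∉ x≢) with P? e
  ... | yes _ = ℕP.+-comm 1 (length (filter P? xs))
  ... | no _ = sym (ℕP.+-identityʳ _)
  length-filter-remove P? {e} (x ∷ xs) (x≢ ∷ u) (there e∈)
    rewrite remove-≢ xs (λ x≡e → All≢⇒∉ x≢ (subst (_∈ xs) (sym x≡e) e∈)) with P? x
  ... | yes _ = cong suc (length-filter-remove P? xs u e∈)
  ... | no _ = length-filter-remove P? xs u e∈

  length-remove : ∀ {e} xs → Unique xs → e ∈ xs → length xs ≡ suc (length (remove xs e))
  length-remove {e} (x ∷ xs) (x≢ ∷ _) (here refl) rewrite remove-head {e} xs | remove-∉ xs (All≢⇒∉ x≢) = refl
  length-remove {e} (x ∷ xs) (x≢ ∷ u) (there e∈)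
    rewrite remove-≢ xs (λ x≡e → All≢⇒∉ x≢ (subst (_∈ xs) (sym x≡e) e∈)) = cong suc (length-remove xs u e∈)

  sumOrderings : (List A → ℕ) → List A → ℕ
  sumOrderings f xs = sumBy f (orderings xs)

  sumOrderings-cong : {f g : List A → ℕ} (xs : List A) → (∀ τ → f τ ≡ g τ) → sumOrderings f xs ≡ sumOrderings g xs
  sumOrderings-cong xs f≗g = sumBy-cong (orderings xs) (λ τ _ → f≗g τ)

  -- An ordering of x ∷ xs inserts x into an ordering of xs; its last element is either x itself
  -- or the last element of that ordering of xs.
  sumOrderings-by-last : ∀ x xs → Unique (x ∷ xs) → ∀ f →
    sumOrderings f (x ∷ xs) ≡ sumBy (λ y → sumOrderings (f ∘ (_∷ʳ y)) (remove (x ∷ xs) y)) (x ∷ xs)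
  sumOrderings-by-last x [] u f rewrite remove-head {x} [] = cong (_+ 0) (sym (ℕP.+-identityʳ (f (x ∷ []))))
  sumOrderings-by-last x (y ∷ ys) (x≢ ∷ u) f = begin
    sumBy f (concatMap (insertions x) (orderings (y ∷ ys)))
      ≡⟨ sumBy-concatMap f (insertions x) (orderings (y ∷ ys)) ⟩
    sumOrderings h (y ∷ ys)
      ≡⟨ sumOrderings-by-last y ys u h ⟩
    sumBy (λ z → sumOrderings (h ∘ (_∷ʳ z)) (remove (y ∷ ys) z)) (y ∷ ys)
      ≡⟨ sumBy-cong (y ∷ ys) split ⟩
    sumBy (λ z → lastZ z + lastX z) (y ∷ ys)
      ≡⟨ sumBy-+ lastZ lastX (y ∷ ys) ⟩
    sumBy lastZ (y ∷ ys) + sumBy lastX (y ∷ ys)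
      ≡⟨ cong (sumBy lastZ (y ∷ ys) +_) lastX-total ⟩
    sumBy lastZ (y ∷ ys) + sumOrderings (f ∘ (_∷ʳ x)) (remove (x ∷ y ∷ ys) x)
      ≡⟨ ℕP.+-comm (sumBy lastZ (y ∷ ys)) _ ⟩
    sumOrderings (f ∘ (_∷ʳ x)) (remove (x ∷ y ∷ ys) x) + sumBy lastZ (y ∷ ys)
      ∎
    where
    open ≡-Reasoning
    h : List A → ℕ
    h τ = sumBy f (insertions x τ)
    x∉ : x ∉ y ∷ ys
    x∉ = All≢⇒∉ x≢
    lastZ lastX : A → ℕ
    lastZ z = sumOrderings (f ∘ (_∷ʳ z)) (remove (x ∷ y ∷ ys) z)
    lastX z = sumOrderings (λ τ → f (τ ∷ʳ z ∷ʳ x)) (remove (y ∷ ys) z)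
    split : ∀ z → z ∈ y ∷ ys → sumOrderings (h ∘ (_∷ʳ z)) (remove (y ∷ ys) z) ≡ lastZ z + lastX z
    split z z∈ = begin
      sumOrderings (h ∘ (_∷ʳ z)) (remove (y ∷ ys) z)
        ≡⟨ sumOrderings-cong (remove (y ∷ ys) z) (λ τ → sumBy-insertions-∷ʳ x z τ f) ⟩
      sumOrderings (λ τ → sumBy (f ∘ (_∷ʳ z)) (insertions x τ) + f (τ ∷ʳ z ∷ʳ x)) (remove (y ∷ ys) z)
        ≡⟨ sumBy-+ _ _ (orderings (remove (y ∷ ys) z)) ⟩
      sumOrderings (λ τ → sumBy (f ∘ (_∷ʳ z)) (insertions x τ)) (remove (y ∷ ys) z) + lastX z
        ≡⟨ cong (_+ lastX z) (sym (sumBy-concatMap (f ∘ (_∷ʳ z)) (insertions x) (orderings (remove (y ∷ ys) z)))) ⟩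
      sumOrderings (f ∘ (_∷ʳ z)) (x ∷ remove (y ∷ ys) z) + lastX z
        ≡⟨ cong (λ L → sumOrderings (f ∘ (_∷ʳ z)) L + lastX z)
                (sym (remove-≢ (y ∷ ys) (λ x≡z → x∉ (subst (_∈ y ∷ ys) (sym x≡z) z∈)))) ⟩
      lastZ z + lastX z
        ∎
    lastX-total : sumBy lastX (y ∷ ys) ≡ sumOrderings (f ∘ (_∷ʳ x)) (remove (x ∷ y ∷ ys) x)
    lastX-total = begin
      sumBy lastX (y ∷ ys)
        ≡⟨ sym (sumOrderings-by-last y ys u (f ∘ (_∷ʳ x))) ⟩
      sumOrderings (f ∘ (_∷ʳ x)) (y ∷ ys)
        ≡⟨ cong (sumOrderings (f ∘ (_∷ʳ x))) (sym (trans (remove-head (y ∷ ys)) (remove-∉ (y ∷ ys) x∉))) ⟩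
      sumOrderings (f ∘ (_∷ʳ x)) (remove (x ∷ y ∷ ys) x)
        ∎

∨-true⁻ : ∀ {a b} → a ∨ b ≡ true → a ≡ true ⊎ b ≡ true
∨-true⁻ {true} _ = inj₁ refl
∨-true⁻ {false} b≡true = inj₂ b≡true

∨-trueˡ : ∀ {a} b → a ≡ true → a ∨ b ≡ true
∨-trueˡ b refl = refl

∨-trueʳ : ∀ a {b} → b ≡ true → a ∨ b ≡ true
∨-trueʳ true _ = refl
∨-trueʳ false b≡true = b≡true

∧-true⁻ : ∀ {a b} → a ∧ b ≡ true → a ≡ true × b ≡ true
∧-true⁻ {true} {true} _ = refl , refl

∧-true⁺ : ∀ {a b} → a ≡ true → b ≡ true → a ∧ b ≡ true
∧-true⁺ refl refl = refl

∧-falseʳ : ∀ a {b} → b ≡ false → a ∧ b ≡ false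
∧-falseʳ true refl = refl
∧-falseʳ false refl = refl

bool-ext : ∀ {a b} → (a ≡ true → b ≡ true) → (b ≡ true → a ≡ true) → a ≡ b
bool-ext {true} {true} _ _ = refl
bool-ext {true} {false} a⇒b _ = sym (a⇒b refl)
bool-ext {false} {true} _ b⇒a = b⇒a refl
bool-ext {false} {false} _ _ = refl

≢true⇒≡false : ∀ {a} → ¬ a ≡ true → a ≡ false
≢true⇒≡false {true} a≢true = ⊥-elim (a≢true refl)
≢true⇒≡false {false} _ = refl

true≢false : ∀ {a} → a ≡ true → a ≡ false → ⊥
true≢false refl ()

eqV⇒≡ : ∀ {n} {u v : Fin n} → eqV u v ≡ true → u ≡ v
eqV⇒≡ {u = u} {v} eq with u FinP.≟ v
... | yes u≡v = u≡v

eqV-refl : ∀ {n} (u : Fin n) → eqV u u ≡ true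
eqV-refl u with u FinP.≟ u
... | yes _ = refl
... | no u≢u = ⊥-elim (u≢u refl)

module _ {A : Set} where

  any⁻ : (p : A → Bool) (xs : List A) → any p xs ≡ true → ∃ λ x → x ∈ xs × p x ≡ true
  any⁻ p (x ∷ xs) any≡true with ∨-true⁻ {p x} any≡true
  ... | inj₁ px = x , here refl , px
  ... | inj₂ rest with any⁻ p xs rest
  ... | y , y∈ , py = y , there y∈ , py

  any⁺ : (p : A → Bool) {x : A} (xs : List A) → x ∈ xs → p x ≡ true → any p xs ≡ true
  any⁺ p (y ∷ xs) (here refl) px = ∨-trueˡ (any p xs) px
  any⁺ p (y ∷ xs) (there x∈) px = ∨-trueʳ (p y) (any⁺ p xs x∈ px)

  any-false⁺ : (p : A → Bool) (xs : List A) → (∀ x → x ∈ xs → ¬ p x ≡ true) → any p xs ≡ false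
  any-false⁺ p xs none = ≢true⇒≡false (λ any≡true → let (x , x∈ , px) = any⁻ p xs any≡true in none x x∈ px)

  any-++ : (p : A → Bool) (xs ys : List A) → any p (xs ++ ys) ≡ any p xs ∨ any p ys
  any-++ p [] ys = refl
  any-++ p (x ∷ xs) ys rewrite any-++ p xs ys = sym (BoolP.∨-assoc (p x) (any p xs) (any p ys))

  any-cong : {p q : A → Bool} (xs : List A) → (∀ x → p x ≡ q x) → any p xs ≡ any q xs
  any-cong [] _ = refl
  any-cong (x ∷ xs) p≗q = cong₂ _∨_ (p≗q x) (any-cong xs p≗q)

  any-map : {B : Set} (p : B → Bool) (f : A → B) (xs : List A) → any p (map f xs) ≡ any (p ∘ f) xs
  any-map p f [] = refl
  any-map p f (x ∷ xs) = cong (p (f x) ∨_) (any-map p f xs)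

count : ∀ {n} → (Fin n → Bool) → ℕ
count {zero} f = 0
count {suc n} f = [ f Fin.zero ]ᵇ + count (f ∘ Fin.suc)

count-cong : ∀ {n} {f g : Fin n → Bool} → (∀ y → f y ≡ g y) → count f ≡ count g
count-cong {zero} _ = refl
count-cong {suc n} f≗g = cong₂ _+_ (cong [_]ᵇ (f≗g Fin.zero)) (count-cong (f≗g ∘ Fin.suc))

count-false : ∀ {n} → count {n} (λ _ → false) ≡ 0
count-false {zero} = refl
count-false {suc n} = count-false {n}

[]ᵇ≤1 : ∀ b → [ b ]ᵇ ℕ.≤ 1
[]ᵇ≤1 true = s≤s z≤n
[]ᵇ≤1 false = z≤n

[]ᵇ-mono : ∀ {a b} → (a ≡ true → b ≡ true) → [ a ]ᵇ ℕ.≤ [ b ]ᵇ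
[]ᵇ-mono {false} _ = z≤n
[]ᵇ-mono {true} a⇒b rewrite a⇒b refl = s≤s z≤n

count≤n : ∀ {n} (f : Fin n → Bool) → count f ℕ.≤ n
count≤n {zero} f = z≤n
count≤n {suc n} f = ℕP.+-mono-≤ ([]ᵇ≤1 (f Fin.zero)) (count≤n (f ∘ Fin.suc))

count-mono : ∀ {n} {f g : Fin n → Bool} → (∀ y → f y ≡ true → g y ≡ true) → count f ℕ.≤ count g
count-mono {zero} _ = z≤n
count-mono {suc n} f⇒g = ℕP.+-mono-≤ ([]ᵇ-mono (f⇒g Fin.zero)) (count-mono (f⇒g ∘ Fin.suc))

count-mono-< : ∀ {n} {f g : Fin n → Bool} → (∀ y → f y ≡ true → g y ≡ true) →
  ∀ y → f y ≡ false → g y ≡ true → count f ℕ.< count g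
count-mono-< {suc n} {f} {g} f⇒g Fin.zero fy gy rewrite fy | gy = s≤s (count-mono (f⇒g ∘ Fin.suc))
count-mono-< {suc n} {f} {g} f⇒g (Fin.suc y) fy gy =
  subst (ℕ._≤ [ g Fin.zero ]ᵇ + count (g ∘ Fin.suc)) (ℕP.+-suc _ _)
    (ℕP.+-mono-≤ ([]ᵇ-mono (f⇒g Fin.zero)) (count-mono-< (f⇒g ∘ Fin.suc) y fy gy))

count>0 : ∀ {n} {f : Fin n → Bool} y → f y ≡ true → 0 ℕ.< count f
count>0 {suc n} {f} Fin.zero fy rewrite fy = s≤s z≤n
count>0 {suc n} {f} (Fin.suc y) fy = ℕP.≤-trans (count>0 y fy) (ℕP.m≤n+m _ _)

count-update : ∀ {n} (f g : Fin n → Bool) a → (∀ y → ¬ y ≡ a → f y ≡ g y) →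
  count g + [ f a ]ᵇ ≡ count f + [ g a ]ᵇ
count-update {suc n} f g Fin.zero agree
  rewrite count-cong {f = f ∘ Fin.suc} {g = g ∘ Fin.suc} (λ y → agree (Fin.suc y) (λ ())) =
  rearrange [ g Fin.zero ]ᵇ (count (g ∘ Fin.suc)) [ f Fin.zero ]ᵇ
  where
  rearrange : ∀ a c b → a + c + b ≡ b + c + a
  rearrange = solve-∀
count-update {suc n} f g (Fin.suc a) agree rewrite agree Fin.zero (λ ()) =
  trans (ℕP.+-assoc [ g Fin.zero ]ᵇ _ _)
    (trans (cong ([ g Fin.zero ]ᵇ +_)
                 (count-update (f ∘ Fin.suc) (g ∘ Fin.suc) a (λ y y≢a → agree (Fin.suc y) (y≢a ∘ FinP.suc-injective))))
           (sym (ℕP.+-assoc [ g Fin.zero ]ᵇ _ _)))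

count-update₂ : ∀ {n} (f g : Fin n → Bool) (a b : Fin n) → ¬ a ≡ b → (∀ y → ¬ y ≡ a → ¬ y ≡ b → f y ≡ g y) →
  count g + ([ f a ]ᵇ + [ f b ]ᵇ) ≡ count f + ([ g a ]ᵇ + [ g b ]ᵇ)
count-update₂ {n} f g a b a≢b agree = begin
  count g + ([ f a ]ᵇ + [ f b ]ᵇ)     ≡⟨ rearrange₁ (count g) [ f a ]ᵇ [ f b ]ᵇ ⟩
  (count g + [ f b ]ᵇ) + [ f a ]ᵇ     ≡⟨ cong (_+ [ f a ]ᵇ) at-b ⟩
  (count mid + [ g b ]ᵇ) + [ f a ]ᵇ   ≡⟨ rearrange₂ (count mid) [ g b ]ᵇ [ f a ]ᵇ ⟩
  (count mid + [ f a ]ᵇ) + [ g b ]ᵇ   ≡⟨ cong (_+ [ g b ]ᵇ) at-a ⟩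
  (count f + [ g a ]ᵇ) + [ g b ]ᵇ     ≡⟨ ℕP.+-assoc (count f) _ _ ⟩
  count f + ([ g a ]ᵇ + [ g b ]ᵇ)     ∎
  where
  open ≡-Reasoning
  rearrange₁ : ∀ x p q → x + (p + q) ≡ (x + q) + p
  rearrange₁ = solve-∀
  rearrange₂ : ∀ x p q → (x + p) + q ≡ (x + q) + p
  rearrange₂ = solve-∀
  mid : Fin n → Bool
  mid y with y FinP.≟ a
  ... | yes _ = g y
  ... | no _ = f y
  mid-a : mid a ≡ g a
  mid-a with a FinP.≟ a
  ... | yes _ = refl
  ... | no a≢a = ⊥-elim (a≢a refl)
  mid-b : mid b ≡ f b
  mid-b with b FinP.≟ a
  ... | yes b≡a = ⊥-elim (a≢b (sym b≡a))
  ... | no _ = refl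
  at-a : count mid + [ f a ]ᵇ ≡ count f + [ g a ]ᵇ
  at-a = trans (count-update f mid a f≗mid) (cong (λ z → count f + [ z ]ᵇ) mid-a)
    where
    f≗mid : ∀ y → ¬ y ≡ a → f y ≡ mid y
    f≗mid y y≢a with y FinP.≟ a
    ... | yes y≡a = ⊥-elim (y≢a y≡a)
    ... | no _ = refl
  at-b : count g + [ f b ]ᵇ ≡ count mid + [ g b ]ᵇ
  at-b = trans (cong (λ z → count g + [ z ]ᵇ) (sym mid-b)) (count-update mid g b mid≗g)
    where
    mid≗g : ∀ y → ¬ y ≡ b → mid y ≡ g y
    mid≗g y y≢b with y FinP.≟ a
    ... | yes _ = refl
    ... | no y≢a = agree y y≢a y≢b

length-filter-tabulate : {A : Set} {n : ℕ} (h : A → Bool) (g : Fin n → A) →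
  length (filter (λ v → h v BoolP.≟ true) (tabulate g)) ≡ count (h ∘ g)
length-filter-tabulate {n = zero} h g = refl
length-filter-tabulate {n = suc n} h g with h (g Fin.zero) | length-filter-tabulate h (g ∘ Fin.suc)
... | true | ih = cong suc ih
... | false | ih = ih

least-witness : ∀ {n} (P : Fin n → Bool) y → P y ≡ true →
  Σ (Fin n) λ c → P c ≡ true × (∀ w → w Fin.< c → P w ≡ false)
least-witness {suc n} P Fin.zero py = Fin.zero , py , (λ w ())
least-witness {suc n} P (Fin.suc y) py with P Fin.zero in eq
... | true = Fin.zero , eq , (λ w ())
... | false with least-witness (P ∘ Fin.suc) y py
... | c , pc , below = Fin.suc c , pc , λ { Fin.zero _ → eq ; (Fin.suc w) (s≤s w<c) → below w w<c }

Graph : ℕ → Set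
Graph n = List (Edge n)

module _ {n : ℕ} where

  adj-sym : ∀ (F : Graph n) x y → adj F x y ≡ adj F y x
  adj-sym F x y = any-cong F (λ e → BoolP.∨-comm (eqV (proj₁ e) x ∧ eqV (proj₂ e) y) (eqV (proj₁ e) y ∧ eqV (proj₂ e) x))

  adj⇒nonIsolatedˡ : ∀ (F : Graph n) x y → adj F x y ≡ true → nonIsolated F x ≡ true
  adj⇒nonIsolatedˡ F x y xy with any⁻ _ F xy
  ... | (p , q) , e∈ , e-xy with ∨-true⁻ {eqV p x ∧ eqV q y} e-xy
  ... | inj₁ pq = any⁺ _ F e∈ (∨-trueˡ (eqV q x) (proj₁ (∧-true⁻ pq)))
  ... | inj₂ qp = any⁺ _ F e∈ (∨-trueʳ (eqV p x) (proj₂ (∧-true⁻ {eqV p y} qp)))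

  adj⇒nonIsolatedʳ : ∀ (F : Graph n) x y → adj F x y ≡ true → nonIsolated F y ≡ true
  adj⇒nonIsolatedʳ F x y xy = adj⇒nonIsolatedˡ F y x (trans (adj-sym F y x) xy)

  adj-++ : ∀ (F H : Graph n) x y → adj (F ++ H) x y ≡ adj F x y ∨ adj H x y
  adj-++ F H x y = any-++ _ F H

  nonIsolated-++ : ∀ (F H : Graph n) x → nonIsolated (F ++ H) x ≡ nonIsolated F x ∨ nonIsolated H x
  nonIsolated-++ F H x = any-++ _ F H

  adj-edge⁻ : ∀ (p q x y : Fin n) → adj ((p , q) ∷ []) x y ≡ true → (x ≡ p × y ≡ q) ⊎ (x ≡ q × y ≡ p)
  adj-edge⁻ p q x y xy with ∨-true⁻ {(eqV p x ∧ eqV q y) ∨ (eqV p y ∧ eqV q x)} xy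
  ... | inj₂ ()
  ... | inj₁ xy′ with ∨-true⁻ {eqV p x ∧ eqV q y} xy′
  ... | inj₁ pq = inj₁ (sym (eqV⇒≡ (proj₁ (∧-true⁻ pq))) , sym (eqV⇒≡ (proj₂ (∧-true⁻ {eqV p x} pq))))
  ... | inj₂ qp = inj₂ (sym (eqV⇒≡ (proj₂ (∧-true⁻ {eqV p y} qp))) , sym (eqV⇒≡ (proj₁ (∧-true⁻ qp))))

  adj-edge⁺ : ∀ (p q : Fin n) → adj ((p , q) ∷ []) p q ≡ true
  adj-edge⁺ p q rewrite eqV-refl p | eqV-refl q = refl

  nonIsolated-edge⁻ : ∀ (p q y : Fin n) → nonIsolated ((p , q) ∷ []) y ≡ true → y ≡ p ⊎ y ≡ q
  nonIsolated-edge⁻ p q y py with ∨-true⁻ {eqV p y ∨ eqV q y} py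
  ... | inj₂ ()
  ... | inj₁ py′ with ∨-true⁻ {eqV p y} py′
  ... | inj₁ p≡y = inj₁ (sym (eqV⇒≡ p≡y))
  ... | inj₂ q≡y = inj₂ (sym (eqV⇒≡ q≡y))

  nonIsolated-edgeˡ : ∀ (p q : Fin n) → nonIsolated ((p , q) ∷ []) p ≡ true
  nonIsolated-edgeˡ p q rewrite eqV-refl p = refl

  nonIsolated-edgeʳ : ∀ (p q : Fin n) → nonIsolated ((p , q) ∷ []) q ≡ true
  nonIsolated-edgeʳ p q rewrite eqV-refl q = ∨-trueˡ false (∨-trueʳ (eqV p q) refl)

  adj-edge-flip : ∀ (p q x y : Fin n) → adj ((q , p) ∷ []) x y ≡ adj ((p , q) ∷ []) x y
  adj-edge-flip p q x y = cong (_∨ false) (trans (BoolP.∨-comm (eqV q x ∧ eqV p y) (eqV q y ∧ eqV p x))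
                                                 (cong₂ _∨_ (BoolP.∧-comm (eqV q y) (eqV p x)) (BoolP.∧-comm (eqV q x) (eqV p y))))

  nonIsolated-edge-flip : ∀ (p q x : Fin n) → nonIsolated ((q , p) ∷ []) x ≡ nonIsolated ((p , q) ∷ []) x
  nonIsolated-edge-flip p q x = cong (_∨ false) (BoolP.∨-comm (eqV q x) (eqV p x))

  data Reach (F : Graph n) (x : Fin n) : Fin n → Set where
    start : Reach F x x
    step : ∀ {y z} → Reach F x y → adj F y z ≡ true → Reach F x z

  reach-trans : ∀ {F x y z} → Reach F x y → Reach F y z → Reach F x z
  reach-trans xy start = xy
  reach-trans xy (step yz adj-yz) = step (reach-trans xy yz) adj-yz

  reach-sym : ∀ {F x y} → Reach F x y → Reach F y x
  reach-sym start = start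
  reach-sym {F} (step {y} {z} xy adj-yz) = reach-trans (step start (trans (adj-sym F z y) adj-yz)) (reach-sym xy)

  reach-mono : ∀ {F H : Graph n} → (∀ x y → adj F x y ≡ true → adj H x y ≡ true) → ∀ {x y} → Reach F x y → Reach H x y
  reach-mono F⊆H start = start
  reach-mono F⊆H (step xy adj-yz) = step (reach-mono F⊆H xy) (F⊆H _ _ adj-yz)

  reach-from-isolated : ∀ {F a y} → nonIsolated F a ≡ false → Reach F a y → y ≡ a
  reach-from-isolated a-iso start = refl
  reach-from-isolated {F} a-iso (step ay adj-yz) with reach-from-isolated a-iso ay
  ... | refl = ⊥-elim (true≢false (adj⇒nonIsolatedˡ F _ _ adj-yz) a-iso)

  reach⇒≡⊎nonIsolated : ∀ {F x y} → Reach F x y → x ≡ y ⊎ nonIsolated F y ≡ true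
  reach⇒≡⊎nonIsolated start = inj₁ refl
  reach⇒≡⊎nonIsolated {F} (step _ adj-yz) = inj₂ (adj⇒nonIsolatedʳ F _ _ adj-yz)

  reachIn⇒Reach : ∀ (F : Graph n) s x y → reachIn F s x y ≡ true → Reach F x y
  reachIn⇒Reach F zero x y x≡y with eqV⇒≡ x≡y
  ... | refl = start
  reachIn⇒Reach F (suc s) x y xy with ∨-true⁻ {reachIn F s x y} xy
  ... | inj₁ xy′ = reachIn⇒Reach F s x y xy′
  ... | inj₂ via with any⁻ _ (allFin n) via
  ... | w , _ , xwy = step (reachIn⇒Reach F s x w (proj₁ (∧-true⁻ xwy))) (proj₂ (∧-true⁻ {reachIn F s x w} xwy))

  Reach⇒reachIn : ∀ {F : Graph n} {x y} → Reach F x y → ∃ λ s → reachIn F s x y ≡ true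
  Reach⇒reachIn {F} {x} start = 0 , eqV-refl x
  Reach⇒reachIn {F} {x} (step {y} {z} xy adj-yz) with Reach⇒reachIn xy
  ... | s , xy′ = suc s , ∨-trueʳ (reachIn F s x z)
                            (any⁺ (λ w → reachIn F s x w ∧ adj F w z) (allFin n) (∈-allFin y) (∧-true⁺ xy′ adj-yz))

  reachIn-cong : {F H : Graph n} → (∀ x y → adj F x y ≡ adj H x y) → ∀ s x y → reachIn F s x y ≡ reachIn H s x y
  reachIn-cong F≗H zero x y = refl
  reachIn-cong F≗H (suc s) x y =
    cong₂ _∨_ (reachIn-cong F≗H s x y) (any-cong (allFin n) (λ w → cong₂ _∧_ (reachIn-cong F≗H s x w) (F≗H w y)))

implies? : ∀ a b → Dec (a ≡ true → b ≡ true)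
implies? false b = yes (λ ())
implies? true true = yes (λ _ → refl)
implies? true false = no (λ t⇒f → true≢false (t⇒f refl) refl)

¬implies : ∀ {a b} → ¬ (a ≡ true → b ≡ true) → a ≡ true × b ≡ false
¬implies {false} {b} ¬a⇒b = ⊥-elim (¬a⇒b (λ ()))
¬implies {true} {true} ¬a⇒b = ⊥-elim (¬a⇒b (λ _ → refl))
¬implies {true} {false} _ = refl , refl

module Saturation {n : ℕ} (F : Graph n) (x : Fin n) where

  private
    R : ℕ → Fin n → Bool
    R s = reachIn F s x

  reachIn-suc : ∀ s y → R s y ≡ true → R (suc s) y ≡ true
  reachIn-suc s y = ∨-trueˡ _

  reachIn-mono : ∀ {s t} → s ℕ.≤ t → ∀ y → R s y ≡ true → R t y ≡ true
  reachIn-mono {s} s≤t y xy = go (ℕP.≤⇒≤′ s≤t)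
    where
    go : ∀ {t} → s ℕ.≤′ t → R t y ≡ true
    go ℕ.≤′-refl = xy
    go (ℕ.≤′-step {t} s≤t) = reachIn-suc t y (go s≤t)

  Saturated : ℕ → Set
  Saturated s = ∀ y → R (suc s) y ≡ true → R s y ≡ true

  saturated-suc : ∀ s → Saturated s → Saturated (suc s)
  saturated-suc s sat y xy with ∨-true⁻ {R (suc s) y} xy
  ... | inj₁ xy′ = xy′
  ... | inj₂ via with any⁻ _ (allFin n) via
  ... | w , _ , xwy = ∨-trueʳ (R s y) (any⁺ (λ w → R s w ∧ adj F w y) (allFin n) (∈-allFin w)
                        (∧-true⁺ (sat w (proj₁ (∧-true⁻ xwy))) (proj₂ (∧-true⁻ {R (suc s) w} xwy))))

  saturated-≤′ : ∀ {t s} → Saturated t → t ℕ.≤′ s → Saturated s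
  saturated-≤′ sat ℕ.≤′-refl = sat
  saturated-≤′ sat (ℕ.≤′-step {s} t≤s) = saturated-suc s (saturated-≤′ sat t≤s)

  saturated-reach : ∀ {t s} → Saturated t → t ℕ.≤′ s → ∀ y → R s y ≡ true → R t y ≡ true
  saturated-reach sat ℕ.≤′-refl y xy = xy
  saturated-reach sat (ℕ.≤′-step t≤s) y xy = saturated-reach sat t≤s y (saturated-≤′ sat t≤s y xy)

  -- Until the radius saturates, every step adds a vertex, so more than s vertices are within radius s.
  saturated⊎grows : ∀ s → (∃ λ t → t ℕ.≤ s × Saturated t) ⊎ (s ℕ.< count (R s))
  saturated⊎grows zero = inj₂ (count>0 x (eqV-refl x))
  saturated⊎grows (suc s) with saturated⊎grows s
  ... | inj₁ (t , t≤s , sat) = inj₁ (t , ℕP.m≤n⇒m≤1+n t≤s , sat)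
  ... | inj₂ s<count with FinP.all? (λ y → implies? (R (suc s) y) (R s y))
  ... | yes sat = inj₁ (s , ℕP.n≤1+n s , sat)
  ... | no ¬sat with FinP.¬∀⟶∃¬ n _ (λ y → implies? (R (suc s) y) (R s y)) ¬sat
  ... | y , new = inj₂ (ℕP.<-≤-trans (s≤s s<count)
                         (count-mono-< (reachIn-suc s) y (proj₂ (¬implies new)) (proj₁ (¬implies new))))

  reachIn-saturates : ∀ s y → R s y ≡ true → R n y ≡ true
  reachIn-saturates s y xy with saturated⊎grows n
  ... | inj₂ n<count = ⊥-elim (ℕP.<-irrefl refl (ℕP.<-≤-trans n<count (count≤n (R n))))
  ... | inj₁ (t , t≤n , sat) = reachIn-mono t≤n y within-t
    where
    within-t : R t y ≡ true
    within-t with ℕP.≤-total s t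
    ... | inj₁ s≤t = reachIn-mono s≤t y xy
    ... | inj₂ t≤s = saturated-reach sat (ℕP.≤⇒≤′ t≤s) y xy

module _ {n : ℕ} where

  connected⇒Reach : ∀ (F : Graph n) x y → connected F x y ≡ true → Reach F x y
  connected⇒Reach F x y = reachIn⇒Reach F n x y

  Reach⇒connected : ∀ {F : Graph n} {x y} → Reach F x y → connected F x y ≡ true
  Reach⇒connected {F} {x} {y} xy with Reach⇒reachIn xy
  ... | s , xy′ = Saturation.reachIn-saturates F x s y xy′

  isRepresentative : Graph n → Fin n → Bool
  isRepresentative F x = nonIsolated F x ∧ isLeastInComponent F x

  componentCount≡count : ∀ (F : Graph n) → componentCount F ≡ count (isRepresentative F)
  componentCount≡count F = length-filter-tabulate (isRepresentative F) (λ v → v)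

  componentCount-cong : {F H : Graph n} → (∀ x y → adj F x y ≡ adj H x y) → (∀ x → nonIsolated F x ≡ nonIsolated H x) →
    componentCount F ≡ componentCount H
  componentCount-cong {F} {H} adj≗ nonIsolated≗ = begin
    componentCount F                ≡⟨ componentCount≡count F ⟩
    count (isRepresentative F)      ≡⟨ count-cong (λ x → cong₂ _∧_ (nonIsolated≗ x) (least≗ x)) ⟩
    count (isRepresentative H)      ≡⟨ componentCount≡count H ⟨
    componentCount H                ∎
    where
    open ≡-Reasoning
    least≗ : ∀ x → isLeastInComponent F x ≡ isLeastInComponent H x
    least≗ x = cong not (any-cong (allFin n) (λ w → cong (⌊ w Fin.<? x ⌋ ∧_) (reachIn-cong adj≗ n x w)))

  <ᵇ⇒< : ∀ {w x : Fin n} → ⌊ w Fin.<? x ⌋ ≡ true → w Fin.< x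
  <ᵇ⇒< {w} {x} w<x with w Fin.<? x
  ... | yes w<x = w<x

  <⇒<ᵇ : ∀ {w x : Fin n} → w Fin.< x → ⌊ w Fin.<? x ⌋ ≡ true
  <⇒<ᵇ {w} {x} w<x with w Fin.<? x
  ... | yes _ = refl
  ... | no w≮x = ⊥-elim (w≮x w<x)

  isLeast⇒¬Reach-below : ∀ (F : Graph n) x → isLeastInComponent F x ≡ true → ∀ w → w Fin.< x → ¬ Reach F x w
  isLeast⇒¬Reach-below F x least w w<x xw =
    true≢false (any⁺ (λ w → ⌊ w Fin.<? x ⌋ ∧ connected F x w) (allFin n) (∈-allFin w)
                     (∧-true⁺ (<⇒<ᵇ w<x) (Reach⇒connected xw)))
               (not-true least)
    where
    not-true : ∀ {b} → not b ≡ true → b ≡ false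
    not-true {false} _ = refl

  ¬Reach-below⇒isLeast : ∀ (F : Graph n) x → (∀ w → w Fin.< x → ¬ Reach F x w) → isLeastInComponent F x ≡ true
  ¬Reach-below⇒isLeast F x none-below
    rewrite any-false⁺ (λ w → ⌊ w Fin.<? x ⌋ ∧ connected F x w) (allFin n)
              (λ w _ w<x∧xw → none-below w (<ᵇ⇒< (proj₁ (∧-true⁻ w<x∧xw)))
                                 (connected⇒Reach F x w (proj₂ (∧-true⁻ {⌊ w Fin.<? x ⌋} w<x∧xw)))) = refl

  Reach-below⇒¬isLeast : ∀ (F : Graph n) x w → w Fin.< x → Reach F x w → isLeastInComponent F x ≡ false
  Reach-below⇒¬isLeast F x w w<x xw = ≢true⇒≡false (λ least → isLeast⇒¬Reach-below F x least w w<x xw)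

count-update₂-suc : ∀ {p q fa fb ga gb} → p + ([ fa ]ᵇ + [ fb ]ᵇ) ≡ q + ([ ga ]ᵇ + [ gb ]ᵇ) →
  fa ≡ false → fb ≡ false → ga ≡ false → gb ≡ true → p ≡ suc q
count-update₂-suc {p} {q} eq refl refl refl refl = trans (sym (ℕP.+-identityʳ p)) (trans eq (ℕP.+-comm q 1))

count-update₂-swap : ∀ {p q fa fc ga gc} t → p + ([ fa ]ᵇ + [ fc ]ᵇ) ≡ q + ([ ga ]ᵇ + [ gc ]ᵇ) →
  fa ≡ false → fc ≡ true → ga ≡ t → gc ≡ not t → p ≡ q
count-update₂-swap {p} {q} true eq refl refl refl refl = ℕP.+-cancelʳ-≡ 1 p q eq
count-update₂-swap {p} {q} false eq refl refl refl refl = ℕP.+-cancelʳ-≡ 1 p q eq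

module JoinIsolated {n : ℕ} (F : Graph n) (a b : Fin n) (a≢b : ¬ a ≡ b) (a-iso : nonIsolated F a ≡ false) where

  F′ : Graph n
  F′ = F ++ (a , b) ∷ []

  b≢a : ¬ b ≡ a
  b≢a = a≢b ∘ sym

  adj′⁻ : ∀ y z → adj F′ y z ≡ true → adj F y z ≡ true ⊎ ((y ≡ a × z ≡ b) ⊎ (y ≡ b × z ≡ a))
  adj′⁻ y z yz rewrite adj-++ F ((a , b) ∷ []) y z with ∨-true⁻ {adj F y z} yz
  ... | inj₁ yz′ = inj₁ yz′
  ... | inj₂ ab = inj₂ (adj-edge⁻ a b y z ab)

  adj′⁺ : ∀ y z → adj F y z ≡ true → adj F′ y z ≡ true
  adj′⁺ y z yz rewrite adj-++ F ((a , b) ∷ []) y z = ∨-trueˡ _ yz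

  adj′-ab : adj F′ a b ≡ true
  adj′-ab rewrite adj-++ F ((a , b) ∷ []) a b = ∨-trueʳ (adj F a b) (adj-edge⁺ a b)

  nonIsolated′⁻ : ∀ y → nonIsolated F′ y ≡ true → nonIsolated F y ≡ true ⊎ (y ≡ a ⊎ y ≡ b)
  nonIsolated′⁻ y ny rewrite nonIsolated-++ F ((a , b) ∷ []) y with ∨-true⁻ {nonIsolated F y} ny
  ... | inj₁ ny′ = inj₁ ny′
  ... | inj₂ ab = inj₂ (nonIsolated-edge⁻ a b y ab)

  nonIsolated′⁺ : ∀ y → nonIsolated F y ≡ true → nonIsolated F′ y ≡ true
  nonIsolated′⁺ y ny rewrite nonIsolated-++ F ((a , b) ∷ []) y = ∨-trueˡ _ ny

  nonIsolated′-a : nonIsolated F′ a ≡ true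
  nonIsolated′-a rewrite nonIsolated-++ F ((a , b) ∷ []) a = ∨-trueʳ (nonIsolated F a) (nonIsolated-edgeˡ a b)

  nonIsolated′-b : nonIsolated F′ b ≡ true
  nonIsolated′-b rewrite nonIsolated-++ F ((a , b) ∷ []) b = ∨-trueʳ (nonIsolated F b) (nonIsolated-edgeʳ a b)

  lift : ∀ {y z} → Reach F y z → Reach F′ y z
  lift = reach-mono adj′⁺

  -- Walks in F′ become walks in F once a is identified with b.
  ρ : Fin n → Fin n
  ρ z with z FinP.≟ a
  ... | yes _ = b
  ... | no _ = z

  ρ-a : ρ a ≡ b
  ρ-a with a FinP.≟ a
  ... | yes _ = refl
  ... | no a≢a = ⊥-elim (a≢a refl)

  ρ-≢ : ∀ {z} → ¬ z ≡ a → ρ z ≡ z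
  ρ-≢ {z} z≢a with z FinP.≟ a
  ... | yes z≡a = ⊥-elim (z≢a z≡a)
  ... | no _ = refl

  adj⇒≢aˡ : ∀ y z → adj F y z ≡ true → ¬ y ≡ a
  adj⇒≢aˡ y z yz refl = true≢false (adj⇒nonIsolatedˡ F y z yz) a-iso

  adj⇒≢aʳ : ∀ y z → adj F y z ≡ true → ¬ z ≡ a
  adj⇒≢aʳ y z yz refl = true≢false (adj⇒nonIsolatedʳ F y z yz) a-iso

  collapse : ∀ {y z} → Reach F′ y z → Reach F (ρ y) (ρ z)
  collapse start = start
  collapse {y} (step {w} {z} yw wz) with adj′⁻ w z wz
  ... | inj₁ wz′ = subst (Reach F (ρ y)) (sym (ρ-≢ (adj⇒≢aʳ w z wz′)))
                     (step (subst (Reach F (ρ y)) (ρ-≢ (adj⇒≢aˡ w z wz′)) (collapse yw)) wz′)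
  ... | inj₂ (inj₁ (refl , refl)) = subst (Reach F (ρ y)) (trans ρ-a (sym (ρ-≢ b≢a))) (collapse yw)
  ... | inj₂ (inj₂ (refl , refl)) = subst (Reach F (ρ y)) (trans (ρ-≢ b≢a) (sym ρ-a)) (collapse yw)

  reach-ρ : ∀ y → Reach F′ y (ρ y)
  reach-ρ y with y FinP.≟ a
  ... | yes refl = step start adj′-ab
  ... | no _ = start

  expand : ∀ {y z} → Reach F (ρ y) (ρ z) → Reach F′ y z
  expand {y} {z} yz = reach-trans (reach-ρ y) (reach-trans (lift yz) (reach-sym (reach-ρ z)))

  isLeast′≡isLeast : ∀ y → ¬ y ≡ a → ¬ Reach F y b → isLeastInComponent F′ y ≡ isLeastInComponent F y
  isLeast′≡isLeast y y≢a ¬yb = bool-ext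
    (λ least′ → ¬Reach-below⇒isLeast F y (λ w w<y yw → isLeast⇒¬Reach-below F′ y least′ w w<y (lift yw)))
    (λ least → ¬Reach-below⇒isLeast F′ y (λ w w<y yw →
                 no-ρ-below w w<y (subst (λ t → Reach F t (ρ w)) (ρ-≢ y≢a) (collapse yw)) least))
    where
    no-ρ-below : ∀ w → w Fin.< y → Reach F y (ρ w) → isLeastInComponent F y ≡ true → ⊥
    no-ρ-below w w<y yw least with w FinP.≟ a
    ... | yes _ = ¬yb yw
    ... | no _ = isLeast⇒¬Reach-below F y least w w<y yw

  nonIsolated′≡nonIsolated : ∀ y → ¬ y ≡ a → (¬ y ≡ b ⊎ nonIsolated F b ≡ true) → nonIsolated F′ y ≡ nonIsolated F y
  nonIsolated′≡nonIsolated y y≢a y≢b⊎b-covered = bool-ext (from′ y≢b⊎b-covered) (nonIsolated′⁺ y)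
    where
    from′ : (¬ y ≡ b ⊎ nonIsolated F b ≡ true) → nonIsolated F′ y ≡ true → nonIsolated F y ≡ true
    from′ _ ny with nonIsolated′⁻ y ny
    ... | inj₁ ny′ = ny′
    ... | inj₂ (inj₁ y≡a) = ⊥-elim (y≢a y≡a)
    from′ (inj₁ y≢b) _ | inj₂ (inj₂ y≡b) = ⊥-elim (y≢b y≡b)
    from′ (inj₂ b-covered) _ | inj₂ (inj₂ refl) = b-covered

  a-not-rep : isRepresentative F a ≡ false
  a-not-rep rewrite a-iso = refl

  -- The new component {a , b} is represented by b; no other representative changes.
  componentCount-join-isolated : nonIsolated F b ≡ false → b Fin.< a → componentCount F′ ≡ suc (componentCount F)
  componentCount-join-isolated b-iso b<a rewrite componentCount≡count F′ | componentCount≡count F =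
    count-update₂-suc (count-update₂ (isRepresentative F) (isRepresentative F′) a b a≢b agree)
                      a-not-rep b-not-rep a-not-rep′ b-rep′
    where
    agree : ∀ y → ¬ y ≡ a → ¬ y ≡ b → isRepresentative F y ≡ isRepresentative F′ y
    agree y y≢a y≢b = sym (cong₂ _∧_ (nonIsolated′≡nonIsolated y y≢a (inj₁ y≢b))
                                     (isLeast′≡isLeast y y≢a (λ yb → y≢b (reach-from-isolated b-iso (reach-sym yb)))))
    b-not-rep : isRepresentative F b ≡ false
    b-not-rep rewrite b-iso = refl
    a-not-rep′ : isRepresentative F′ a ≡ false
    a-not-rep′ = ∧-falseʳ (nonIsolated F′ a) (Reach-below⇒¬isLeast F′ a b b<a (step start adj′-ab))
    b-rep′ : isRepresentative F′ b ≡ true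
    b-rep′ = ∧-true⁺ nonIsolated′-b (¬Reach-below⇒isLeast F′ b none-below)
      where
      none-below : ∀ w → w Fin.< b → ¬ Reach F′ b w
      none-below w w<b bw with w FinP.≟ a
      ... | yes refl = ℕP.<-asym w<b b<a
      ... | no w≢a = ℕP.<-irrefl (cong toℕ (trans (sym (ρ-≢ w≢a))
                       (reach-from-isolated b-iso (subst (λ t → Reach F t (ρ w)) (ρ-≢ b≢a) (collapse bw))))) w<b

  -- With c the least vertex of the component of b, the representatives of F and F′ differ
  -- at most at a and c, and exactly one of the two represents the enlarged component.
  componentCount-join-covered : nonIsolated F b ≡ true → componentCount F′ ≡ componentCount F
  componentCount-join-covered b-covered rewrite componentCount≡count F′ | componentCount≡count F =
    by-order (FinP.<-cmp a c)
    where
    least-of-b : Σ (Fin n) λ c → connected F b c ≡ true × (∀ w → w Fin.< c → connected F b w ≡ false)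
    least-of-b = least-witness (connected F b) b (Reach⇒connected {F = F} start)
    c : Fin n
    c = proj₁ least-of-b
    bc : Reach F b c
    bc = connected⇒Reach F b c (proj₁ (proj₂ least-of-b))
    c-least : ∀ w → w Fin.< c → ¬ Reach F b w
    c-least w w<c bw = true≢false (Reach⇒connected bw) (proj₂ (proj₂ least-of-b) w w<c)
    c≢a : ¬ c ≡ a
    c≢a c≡a = a≢b (sym (reach-from-isolated a-iso (reach-sym (subst (Reach F b) c≡a bc))))
    c-covered : nonIsolated F c ≡ true
    c-covered with reach⇒≡⊎nonIsolated bc
    ... | inj₁ b≡c = subst (λ t → nonIsolated F t ≡ true) b≡c b-covered
    ... | inj₂ c-covered′ = c-covered′
    c-rep : isRepresentative F c ≡ true
    c-rep = ∧-true⁺ c-covered (¬Reach-below⇒isLeast F c (λ w w<c cw → c-least w w<c (reach-trans bc cw)))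
    agree : ∀ y → ¬ y ≡ a → ¬ y ≡ c → isRepresentative F y ≡ isRepresentative F′ y
    agree y y≢a y≢c with connected F b y in by
    ... | false = sym (cong₂ _∧_ (nonIsolated′≡nonIsolated y y≢a (inj₂ b-covered))
                        (isLeast′≡isLeast y y≢a (λ yb → true≢false (Reach⇒connected (reach-sym yb)) by)))
    ... | true = trans (∧-falseʳ (nonIsolated F y) (Reach-below⇒¬isLeast F y c c<y yc))
                       (sym (∧-falseʳ (nonIsolated F′ y) (Reach-below⇒¬isLeast F′ y c c<y (lift yc))))
      where
      yc : Reach F y c
      yc = reach-trans (reach-sym (connected⇒Reach F b y by)) bc
      c<y : c Fin.< y
      c<y with FinP.<-cmp y c
      ... | tri< y<c _ _ = ⊥-elim (c-least y y<c (connected⇒Reach F b y by))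
      ... | tri≈ _ y≡c _ = ⊥-elim (y≢c y≡c)
      ... | tri> _ _ c<y = c<y
    changes : count (isRepresentative F′) + ([ isRepresentative F a ]ᵇ + [ isRepresentative F c ]ᵇ)
            ≡ count (isRepresentative F) + ([ isRepresentative F′ a ]ᵇ + [ isRepresentative F′ c ]ᵇ)
    changes = count-update₂ (isRepresentative F) (isRepresentative F′) a c (c≢a ∘ sym) agree
    a-rep′ : a Fin.< c → isRepresentative F′ a ≡ true
    a-rep′ a<c = ∧-true⁺ nonIsolated′-a (¬Reach-below⇒isLeast F′ a none-below)
      where
      none-below : ∀ w → w Fin.< a → ¬ Reach F′ a w
      none-below w w<a aw = c-least w (FinP.<-trans w<a a<c)
                              (subst₂ (Reach F) ρ-a (ρ-≢ (λ w≡a → ℕP.<-irrefl (cong toℕ w≡a) w<a)) (collapse aw))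
    c-not-rep′ : a Fin.< c → isRepresentative F′ c ≡ false
    c-not-rep′ a<c = ∧-falseʳ _ (Reach-below⇒¬isLeast F′ c a a<c
                                  (expand (subst₂ (Reach F) (sym (ρ-≢ c≢a)) (sym ρ-a) (reach-sym bc))))
    a-not-rep′ : c Fin.< a → isRepresentative F′ a ≡ false
    a-not-rep′ c<a = ∧-falseʳ _ (Reach-below⇒¬isLeast F′ a c c<a
                                  (expand (subst₂ (Reach F) (sym ρ-a) (sym (ρ-≢ c≢a)) bc)))
    c-rep′ : c Fin.< a → isRepresentative F′ c ≡ true
    c-rep′ c<a = ∧-true⁺ (nonIsolated′⁺ c c-covered) (¬Reach-below⇒isLeast F′ c none-below)
      where
      none-below : ∀ w → w Fin.< c → ¬ Reach F′ c w
      none-below w w<c cw = c-least w w<c (reach-trans bc (subst₂ (Reach F) (ρ-≢ c≢a)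
                              (ρ-≢ (λ w≡a → ℕP.<-asym (subst (Fin._< c) w≡a w<c) c<a)) (collapse cw)))
    by-order : Tri (a Fin.< c) (a ≡ c) (c Fin.< a) → count (isRepresentative F′) ≡ count (isRepresentative F)
    by-order (tri< a<c _ _) = count-update₂-swap true changes a-not-rep c-rep (a-rep′ a<c) (c-not-rep′ a<c)
    by-order (tri≈ _ a≡c _) = ⊥-elim (c≢a (sym a≡c))
    by-order (tri> _ _ c<a) = count-update₂-swap false changes a-not-rep c-rep (a-not-rep′ c<a) (c-rep′ c<a)

module _ {n : ℕ} where

  seenAfter : List (Fin n) → Graph n → List (Fin n)
  seenAfter s [] = s
  seenAfter s ((u , v) ∷ τ) = seenAfter (u ∷ v ∷ s) τ

  buildFrom-∷ʳ : ∀ (s : List (Fin n)) τ u v →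
    buildFrom s (τ ∷ʳ (u , v)) ≡
      buildFrom s τ ++ (if memV u (seenAfter s τ) ∧ memV v (seenAfter s τ) then [] else (u , v) ∷ [])
  buildFrom-∷ʳ s [] u v = refl
  buildFrom-∷ʳ s ((x , y) ∷ τ) u v with memV x s ∧ memV y s
  ... | true = buildFrom-∷ʳ (x ∷ y ∷ s) τ u v
  ... | false = cong ((x , y) ∷_) (buildFrom-∷ʳ (x ∷ y ∷ s) τ u v)

  memV-∷∷⁻ : ∀ (x u v : Fin n) s → memV x (u ∷ v ∷ s) ≡ true → x ≡ u ⊎ x ≡ v ⊎ memV x s ≡ true
  memV-∷∷⁻ x u v s x∈ with ∨-true⁻ {eqV x u} x∈
  ... | inj₁ x≡u = inj₁ (eqV⇒≡ x≡u)
  ... | inj₂ x∈′ with ∨-true⁻ {eqV x v} x∈′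
  ... | inj₁ x≡v = inj₂ (inj₁ (eqV⇒≡ x≡v))
  ... | inj₂ x∈s = inj₂ (inj₂ x∈s)

  memV-∷∷⁺ : ∀ (x u v : Fin n) s → x ≡ u ⊎ x ≡ v ⊎ memV x s ≡ true → memV x (u ∷ v ∷ s) ≡ true
  memV-∷∷⁺ x u v s (inj₁ refl) = ∨-trueˡ _ (eqV-refl x)
  memV-∷∷⁺ x u v s (inj₂ (inj₁ refl)) = ∨-trueʳ (eqV x u) (∨-trueˡ _ (eqV-refl x))
  memV-∷∷⁺ x u v s (inj₂ (inj₂ x∈s)) = ∨-trueʳ (eqV x u) (∨-trueʳ (eqV x v) x∈s)

  nonIsolated-∷⁻ : ∀ (u v x : Fin n) (τ : Graph n) → nonIsolated ((u , v) ∷ τ) x ≡ true →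
    x ≡ u ⊎ x ≡ v ⊎ nonIsolated τ x ≡ true
  nonIsolated-∷⁻ u v x τ nx with ∨-true⁻ {eqV u x ∨ eqV v x} nx
  ... | inj₂ nx′ = inj₂ (inj₂ nx′)
  ... | inj₁ uv with ∨-true⁻ {eqV u x} uv
  ... | inj₁ u≡x = inj₁ (sym (eqV⇒≡ u≡x))
  ... | inj₂ v≡x = inj₂ (inj₁ (sym (eqV⇒≡ v≡x)))

  nonIsolated-∷⁺ : ∀ (u v x : Fin n) (τ : Graph n) → x ≡ u ⊎ x ≡ v ⊎ nonIsolated τ x ≡ true →
    nonIsolated ((u , v) ∷ τ) x ≡ true
  nonIsolated-∷⁺ u v x τ (inj₁ refl) = ∨-trueˡ _ (∨-trueˡ _ (eqV-refl x))
  nonIsolated-∷⁺ u v x τ (inj₂ (inj₁ refl)) = ∨-trueˡ _ (∨-trueʳ (eqV u x) (eqV-refl x))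
  nonIsolated-∷⁺ u v x τ (inj₂ (inj₂ nx)) = ∨-trueʳ _ nx

  seenAfter-⊇ : ∀ (s : List (Fin n)) τ x → memV x s ≡ true → memV x (seenAfter s τ) ≡ true
  seenAfter-⊇ s [] x x∈ = x∈
  seenAfter-⊇ s ((u , v) ∷ τ) x x∈ = seenAfter-⊇ (u ∷ v ∷ s) τ x (memV-∷∷⁺ x u v s (inj₂ (inj₂ x∈)))

  seenAfter⁻ : ∀ (s : List (Fin n)) τ x → memV x (seenAfter s τ) ≡ true → memV x s ≡ true ⊎ nonIsolated τ x ≡ true
  seenAfter⁻ s [] x x∈ = inj₁ x∈
  seenAfter⁻ s ((u , v) ∷ τ) x x∈ with seenAfter⁻ (u ∷ v ∷ s) τ x x∈
  ... | inj₂ nx = inj₂ (nonIsolated-∷⁺ u v x τ (inj₂ (inj₂ nx)))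
  ... | inj₁ x∈′ with memV-∷∷⁻ x u v s x∈′
  ... | inj₁ x≡u = inj₂ (nonIsolated-∷⁺ u v x τ (inj₁ x≡u))
  ... | inj₂ (inj₁ x≡v) = inj₂ (nonIsolated-∷⁺ u v x τ (inj₂ (inj₁ x≡v)))
  ... | inj₂ (inj₂ x∈s) = inj₁ x∈s

  seenAfter⁺ : ∀ (s : List (Fin n)) τ x → nonIsolated τ x ≡ true → memV x (seenAfter s τ) ≡ true
  seenAfter⁺ s ((u , v) ∷ τ) x nx with nonIsolated-∷⁻ u v x τ nx
  ... | inj₂ (inj₂ nx′) = seenAfter⁺ (u ∷ v ∷ s) τ x nx′
  ... | inj₁ x≡u = seenAfter-⊇ (u ∷ v ∷ s) τ x (memV-∷∷⁺ x u v s (inj₁ x≡u))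
  ... | inj₂ (inj₁ x≡v) = seenAfter-⊇ (u ∷ v ∷ s) τ x (memV-∷∷⁺ x u v s (inj₂ (inj₁ x≡v)))

  memV-seenAfter : ∀ τ x → memV x (seenAfter [] τ) ≡ nonIsolated τ x
  memV-seenAfter τ x = bool-ext from (seenAfter⁺ [] τ x)
    where
    from : memV x (seenAfter [] τ) ≡ true → nonIsolated τ x ≡ true
    from x∈ with seenAfter⁻ [] τ x x∈
    ... | inj₂ nx = nx

  buildFrom-⊆ : ∀ (s : List (Fin n)) τ x → nonIsolated (buildFrom s τ) x ≡ true → nonIsolated τ x ≡ true
  buildFrom-⊆ s ((u , v) ∷ τ) x nx with memV u s ∧ memV v s
  ... | true = nonIsolated-∷⁺ u v x τ (inj₂ (inj₂ (buildFrom-⊆ (u ∷ v ∷ s) τ x nx)))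
  ... | false with nonIsolated-∷⁻ u v x (buildFrom (u ∷ v ∷ s) τ) nx
  ... | inj₁ x≡u = nonIsolated-∷⁺ u v x τ (inj₁ x≡u)
  ... | inj₂ (inj₁ x≡v) = nonIsolated-∷⁺ u v x τ (inj₂ (inj₁ x≡v))
  ... | inj₂ (inj₂ nx′) = nonIsolated-∷⁺ u v x τ (inj₂ (inj₂ (buildFrom-⊆ (u ∷ v ∷ s) τ x nx′)))

  buildFrom-covers : ∀ (s : List (Fin n)) τ x → nonIsolated τ x ≡ true →
    memV x s ≡ true ⊎ nonIsolated (buildFrom s τ) x ≡ true
  buildFrom-covers s ((u , v) ∷ τ) x nx with memV u s ∧ memV v s in uv-seen
  ... | true = skipped (nonIsolated-∷⁻ u v x τ nx)
    where
    seen-u∨v : x ≡ u ⊎ x ≡ v → memV x s ≡ true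
    seen-u∨v (inj₁ refl) = proj₁ (∧-true⁻ uv-seen)
    seen-u∨v (inj₂ refl) = proj₂ (∧-true⁻ {memV u s} uv-seen)
    from-rest : memV x (u ∷ v ∷ s) ≡ true ⊎ nonIsolated (buildFrom (u ∷ v ∷ s) τ) x ≡ true →
      memV x s ≡ true ⊎ nonIsolated (buildFrom (u ∷ v ∷ s) τ) x ≡ true
    from-rest (inj₂ nx′) = inj₂ nx′
    from-rest (inj₁ x∈) with memV-∷∷⁻ x u v s x∈
    ... | inj₁ x≡u = inj₁ (seen-u∨v (inj₁ x≡u))
    ... | inj₂ (inj₁ x≡v) = inj₁ (seen-u∨v (inj₂ x≡v))
    ... | inj₂ (inj₂ x∈s) = inj₁ x∈s
    skipped : x ≡ u ⊎ x ≡ v ⊎ nonIsolated τ x ≡ true →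
      memV x s ≡ true ⊎ nonIsolated (buildFrom (u ∷ v ∷ s) τ) x ≡ true
    skipped (inj₁ x≡u) = inj₁ (seen-u∨v (inj₁ x≡u))
    skipped (inj₂ (inj₁ x≡v)) = inj₁ (seen-u∨v (inj₂ x≡v))
    skipped (inj₂ (inj₂ nx′)) = from-rest (buildFrom-covers (u ∷ v ∷ s) τ x nx′)
  ... | false = kept (nonIsolated-∷⁻ u v x τ nx)
    where
    B : Graph n
    B = buildFrom (u ∷ v ∷ s) τ
    kept : x ≡ u ⊎ x ≡ v ⊎ nonIsolated τ x ≡ true → memV x s ≡ true ⊎ nonIsolated ((u , v) ∷ B) x ≡ true
    kept (inj₁ x≡u) = inj₂ (nonIsolated-∷⁺ u v x B (inj₁ x≡u))
    kept (inj₂ (inj₁ x≡v)) = inj₂ (nonIsolated-∷⁺ u v x B (inj₂ (inj₁ x≡v)))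
    kept (inj₂ (inj₂ nx′)) with buildFrom-covers (u ∷ v ∷ s) τ x nx′
    ... | inj₂ nx″ = inj₂ (nonIsolated-∷⁺ u v x B (inj₂ (inj₂ nx″)))
    ... | inj₁ x∈ with memV-∷∷⁻ x u v s x∈
    ... | inj₁ x≡u = inj₂ (nonIsolated-∷⁺ u v x B (inj₁ x≡u))
    ... | inj₂ (inj₁ x≡v) = inj₂ (nonIsolated-∷⁺ u v x B (inj₂ (inj₁ x≡v)))
    ... | inj₂ (inj₂ x∈s) = inj₁ x∈s

  nonIsolated-buildForest : ∀ τ x → nonIsolated (buildForest τ) x ≡ nonIsolated τ x
  nonIsolated-buildForest τ x = bool-ext (buildFrom-⊆ [] τ x) from
    where
    from : nonIsolated τ x ≡ true → nonIsolated (buildForest τ) x ≡ true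
    from nx with buildFrom-covers [] τ x nx
    ... | inj₂ nx′ = nx′

  nonIsolated-↭ : ∀ {τ D : Graph n} → τ ↭ D → ∀ x → nonIsolated τ x ≡ nonIsolated D x
  nonIsolated-↭ {τ} {D} τ↭D x = bool-ext
    (λ nx → let (e , e∈ , ex) = any⁻ _ τ nx in any⁺ (λ e → eqV (proj₁ e) x ∨ eqV (proj₂ e) x) D (∈-resp-↭ τ↭D e∈) ex)
    (λ nx → let (e , e∈ , ex) = any⁻ _ D nx in any⁺ (λ e → eqV (proj₁ e) x ∨ eqV (proj₂ e) x) τ (∈-resp-↭ (↭-sym τ↭D) e∈) ex)

  componentCount-flip : ∀ (F : Graph n) p q → componentCount (F ++ (q , p) ∷ []) ≡ componentCount (F ++ (p , q) ∷ [])
  componentCount-flip F p q = componentCount-cong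
    (λ x y → trans (adj-++ F _ x y) (trans (cong (adj F x y ∨_) (adj-edge-flip p q x y)) (sym (adj-++ F _ x y))))
    (λ x → trans (nonIsolated-++ F _ x) (trans (cong (nonIsolated F x ∨_) (nonIsolated-edge-flip p q x))
                                               (sym (nonIsolated-++ F _ x))))

  componentCount-buildForest-∷ʳ : ∀ (D τ : Graph n) → (∀ x → nonIsolated τ x ≡ nonIsolated D x) → ∀ u v → u Fin.< v →
    componentCount (buildForest (τ ∷ʳ (u , v))) ≡
      componentCount (buildForest τ) + [ not (nonIsolated D u) ∧ not (nonIsolated D v) ]ᵇ
  componentCount-buildForest-∷ʳ D τ τ≗D u v u<v
    rewrite buildFrom-∷ʳ [] τ u v | memV-seenAfter τ u | memV-seenAfter τ v | τ≗D u | τ≗D v =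
    by-cover _ _ refl refl
    where
    B : Graph n
    B = buildForest τ
    u≢v : ¬ u ≡ v
    u≢v u≡v = ℕP.<-irrefl (cong toℕ u≡v) u<v
    v≢u : ¬ v ≡ u
    v≢u = u≢v ∘ sym
    B-iso : ∀ x → nonIsolated D x ≡ false → nonIsolated B x ≡ false
    B-iso x x-iso = trans (nonIsolated-buildForest τ x) (trans (τ≗D x) x-iso)
    B-cov : ∀ x → nonIsolated D x ≡ true → nonIsolated B x ≡ true
    B-cov x x-cov = trans (nonIsolated-buildForest τ x) (trans (τ≗D x) x-cov)
    by-cover : ∀ cu cv → nonIsolated D u ≡ cu → nonIsolated D v ≡ cv →
      componentCount (B ++ (if cu ∧ cv then [] else (u , v) ∷ [])) ≡ componentCount B + [ not cu ∧ not cv ]ᵇ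
    by-cover true true _ _ = trans (cong componentCount (++-identityʳ B)) (sym (ℕP.+-identityʳ _))
    by-cover false false u-iso v-iso = begin
      componentCount (B ++ (u , v) ∷ [])  ≡⟨ componentCount-flip B v u ⟩
      componentCount (B ++ (v , u) ∷ [])  ≡⟨ JoinIsolated.componentCount-join-isolated B v u v≢u (B-iso v v-iso) (B-iso u u-iso) u<v ⟩
      suc (componentCount B)              ≡⟨ ℕP.+-comm 1 _ ⟩
      componentCount B + 1                ∎
      where open ≡-Reasoning
    by-cover false true u-iso v-cov =
      trans (JoinIsolated.componentCount-join-covered B u v u≢v (B-iso u u-iso) (B-cov v v-cov)) (sym (ℕP.+-identityʳ _))
    by-cover true false u-cov v-iso =
      trans (componentCount-flip B v u)
            (trans (JoinIsolated.componentCount-join-covered B v u v≢u (B-iso v v-iso) (B-cov u u-cov)) (sym (ℕP.+-identityʳ _)))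

divℕ-cross : ∀ a b d e → a * suc e ≡ b * suc d → divℕ a (suc d) ≡ divℕ b (suc e)
divℕ-cross a b d e eq = ℚP.fromℚᵘ-cong {mkℚᵘ (ℤ.+ a) d} {mkℚᵘ (ℤ.+ b) e}
  (*≡* (trans (sym (ℤP.pos-* a (suc e))) (trans (cong ℤ.+_ eq) (ℤP.pos-* b (suc d)))))

divℕ-+ : ∀ a b d e → divℕ a (suc d) ℚ.+ divℕ b (suc e) ≡ divℕ (a * suc e + b * suc d) (suc d * suc e)
divℕ-+ a b d e = ℚP.toℚᵘ-injective
  (ℚᵘP.≃-trans (ℚP.toℚᵘ-homo-+ (divℕ a (suc d)) (divℕ b (suc e)))
  (ℚᵘP.≃-trans (ℚᵘP.+-cong (ℚP.toℚᵘ-fromℚᵘ (mkℚᵘ (ℤ.+ a) d)) (ℚP.toℚᵘ-fromℚᵘ (mkℚᵘ (ℤ.+ b) e)))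
  (ℚᵘP.≃-trans (ℚᵘP.≃-reflexive (cong (λ z → mkℚᵘ z (e + d * suc e)) numerator))
               (ℚᵘP.≃-sym (ℚP.toℚᵘ-fromℚᵘ (mkℚᵘ (ℤ.+ (a * suc e + b * suc d)) (e + d * suc e)))))))
  where
  numerator : ℤ.+ a ℤ.* ℤ.+ suc e ℤ.+ ℤ.+ b ℤ.* ℤ.+ suc d ≡ ℤ.+ (a * suc e + b * suc d)
  numerator = trans (cong₂ ℤ._+_ (sym (ℤP.pos-* a (suc e))) (sym (ℤP.pos-* b (suc d))))
                    (sym (ℤP.pos-+ (a * suc e) (b * suc d)))

divℕ-* : ∀ a b d e → divℕ a (suc d) ℚ.* divℕ b (suc e) ≡ divℕ (a * b) (suc d * suc e)
divℕ-* a b d e = ℚP.toℚᵘ-injective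
  (ℚᵘP.≃-trans (ℚP.toℚᵘ-homo-* (divℕ a (suc d)) (divℕ b (suc e)))
  (ℚᵘP.≃-trans (ℚᵘP.*-cong (ℚP.toℚᵘ-fromℚᵘ (mkℚᵘ (ℤ.+ a) d)) (ℚP.toℚᵘ-fromℚᵘ (mkℚᵘ (ℤ.+ b) e)))
  (ℚᵘP.≃-trans (ℚᵘP.≃-reflexive (cong (λ z → mkℚᵘ z (e + d * suc e)) (sym (ℤP.pos-* a b))))
               (ℚᵘP.≃-sym (ℚP.toℚᵘ-fromℚᵘ (mkℚᵘ (ℤ.+ (a * b)) (e + d * suc e)))))))

divℕ-0 : ∀ d → divℕ 0 (suc d) ≡ 0ℚ
divℕ-0 d = ℚP.0/n≡0 (suc d)

divℕ-+-same : ∀ a b d → divℕ a (suc d) ℚ.+ divℕ b (suc d) ≡ divℕ (a + b) (suc d)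
divℕ-+-same a b d = trans (divℕ-+ a b d d) (divℕ-cross (a * suc d + b * suc d) (a + b) (d + d * suc d) d (rearrange a b (suc d)))
  where
  rearrange : ∀ a b s → (a * s + b * s) * s ≡ (a + b) * (s * s)
  rearrange = solve-∀

divℕ-inverse : ∀ t → divℕ 1 (suc t) ℚ.* divℕ (suc t) 1 ≡ 1ℚ
divℕ-inverse t = trans (divℕ-* 1 (suc t) t 0) (divℕ-cross (1 * suc t) 1 (t * 1) 0 (rearrange t))
  where
  rearrange : ∀ t → (1 * suc t) * 1 ≡ 1 * suc (t * 1)
  rearrange = solve-∀

divℕ-cancelˡ : ∀ t q → divℕ 1 (suc t) ℚ.* (divℕ (suc t) 1 ℚ.* q) ≡ q
divℕ-cancelˡ t q = trans (sym (ℚP.*-assoc (divℕ 1 (suc t)) _ q)) (trans (cong (ℚ._* q) (divℕ-inverse t)) (ℚP.*-identityˡ q))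

divℕ-cancelʳ : ∀ t q → divℕ (suc t) 1 ℚ.* (divℕ 1 (suc t) ℚ.* q) ≡ q
divℕ-cancelʳ t q = trans (sym (ℚP.*-assoc (divℕ (suc t) 1) (divℕ 1 (suc t)) q))
  (trans (cong (ℚ._* q) (trans (ℚP.*-comm (divℕ (suc t) 1) (divℕ 1 (suc t))) (divℕ-inverse t))) (ℚP.*-identityˡ q))

sumℚ-map-cong : {A : Set} {g h : A → ℚ} (L : List A) → (∀ x → x ∈ L → g x ≡ h x) → sumℚ (map g L) ≡ sumℚ (map h L)
sumℚ-map-cong [] _ = refl
sumℚ-map-cong (x ∷ L) g≗h = cong₂ ℚ._+_ (g≗h x (here refl)) (sumℚ-map-cong L (λ y y∈ → g≗h y (there y∈)))

sumℚ-map-++ : {A : Set} (h : A → ℚ) (xs ys : List A) → sumℚ (map h (xs ++ ys)) ≡ sumℚ (map h xs) ℚ.+ sumℚ (map h ys)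
sumℚ-map-++ h [] ys = sym (ℚP.+-identityˡ (sumℚ (map h ys)))
sumℚ-map-++ h (x ∷ xs) ys =
  trans (cong (h x ℚ.+_) (sumℚ-map-++ h xs ys)) (sym (ℚP.+-assoc (h x) (sumℚ (map h xs)) (sumℚ (map h ys))))

sumℚ-map-∘ : {A B : Set} (h : B → ℚ) (g : A → B) (L : List A) → sumℚ (map h (map g L)) ≡ sumℚ (map (h ∘ g) L)
sumℚ-map-∘ h g [] = refl
sumℚ-map-∘ h g (x ∷ L) = cong (h (g x) ℚ.+_) (sumℚ-map-∘ h g L)

sumℚ-map-*ˡ : {A : Set} (c : ℚ) (f : A → ℚ) (L : List A) → sumℚ (map (λ x → c ℚ.* f x) L) ≡ c ℚ.* sumℚ (map f L)
sumℚ-map-*ˡ c f [] = sym (ℚP.*-zeroʳ c)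
sumℚ-map-*ˡ c f (x ∷ L) = trans (cong (c ℚ.* f x ℚ.+_) (sumℚ-map-*ˡ c f L)) (sym (ℚP.*-distribˡ-+ c (f x) _))

sumℚ-map-*ʳ : {A : Set} (c : ℚ) (f : A → ℚ) (L : List A) → sumℚ (map (λ x → f x ℚ.* c) L) ≡ sumℚ (map f L) ℚ.* c
sumℚ-map-*ʳ c f [] = sym (ℚP.*-zeroˡ c)
sumℚ-map-*ʳ c f (x ∷ L) = trans (cong (f x ℚ.* c ℚ.+_) (sumℚ-map-*ʳ c f L)) (sym (ℚP.*-distribʳ-+ c (f x) _))

sumℚ-map-divℕ : {A : Set} (c : A → ℕ) (f : ℕ) (L : List A) →
  sumℚ (map (λ x → divℕ (c x) (suc f)) L) ≡ divℕ (sumBy c L) (suc f)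
sumℚ-map-divℕ c f [] = sym (divℕ-0 f)
sumℚ-map-divℕ c f (x ∷ L) = trans (cong (divℕ (c x) (suc f) ℚ.+_) (sumℚ-map-divℕ c f L)) (divℕ-+-same (c x) (sumBy c L) f)

average≡ : {A : Set} (h : A → ℚ) (L : List A) (t : ℕ) → length L ≡ suc t → average (map h L) ≡ divℕ 1 (suc t) ℚ.* sumℚ (map h L)
average≡ h (x ∷ xs) t len = cong (λ z → divℕ 1 (suc z) ℚ.* sumℚ (map h (x ∷ xs))) (trans (length-map h xs) (ℕP.suc-injective len))

sumTo : ℕ → (ℕ → ℚ) → ℚ
sumTo zero F = 0ℚ
sumTo (suc K) F = F 0 ℚ.+ sumTo K (F ∘ suc)

sumTo-cong : ∀ K {F G : ℕ → ℚ} → (∀ i → i ℕ.< K → F i ≡ G i) → sumTo K F ≡ sumTo K G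
sumTo-cong zero _ = refl
sumTo-cong (suc K) F≗G = cong₂ ℚ._+_ (F≗G 0 (s≤s z≤n)) (sumTo-cong K (λ i i<K → F≗G (suc i) (s≤s i<K)))

sumTo-suc : ∀ K F → sumTo (suc K) F ≡ sumTo K F ℚ.+ F K
sumTo-suc zero F = trans (ℚP.+-identityʳ (F 0)) (sym (ℚP.+-identityˡ (F 0)))
sumTo-suc (suc K) F = trans (cong (F 0 ℚ.+_) (sumTo-suc K (F ∘ suc))) (sym (ℚP.+-assoc (F 0) (sumTo K (F ∘ suc)) (F (suc K))))

sumTo-0 : ∀ K F → (∀ i → F i ≡ 0ℚ) → sumTo K F ≡ 0ℚ
sumTo-0 zero F _ = refl
sumTo-0 (suc K) F F≗0 = trans (cong₂ ℚ._+_ (F≗0 0) (sumTo-0 K (F ∘ suc) (F≗0 ∘ suc))) (ℚP.+-identityʳ 0ℚ)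

sumTo-+ : ∀ K F G → sumTo K (λ i → F i ℚ.+ G i) ≡ sumTo K F ℚ.+ sumTo K G
sumTo-+ zero F G = sym (ℚP.+-identityʳ 0ℚ)
sumTo-+ (suc K) F G = trans (cong (F 0 ℚ.+ G 0 ℚ.+_) (sumTo-+ K (F ∘ suc) (G ∘ suc))) (+-interchange (F 0) (G 0) _ _)

sumTo-*ˡ : ∀ K c F → sumTo K (λ i → c ℚ.* F i) ≡ c ℚ.* sumTo K F
sumTo-*ˡ zero c F = sym (ℚP.*-zeroʳ c)
sumTo-*ˡ (suc K) c F = trans (cong (c ℚ.* F 0 ℚ.+_) (sumTo-*ˡ K c (F ∘ suc))) (sym (ℚP.*-distribˡ-+ c (F 0) _))

sumℚ-map-sumTo : {A : Set} (K : ℕ) (F : A → ℕ → ℚ) (L : List A) →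
  sumℚ (map (λ e → sumTo K (F e)) L) ≡ sumTo K (λ i → sumℚ (map (λ e → F e i) L))
sumℚ-map-sumTo K F [] = sym (sumTo-0 K (λ _ → 0ℚ) (λ _ → refl))
sumℚ-map-sumTo K F (e ∷ L) =
  trans (cong (sumTo K (F e) ℚ.+_) (sumℚ-map-sumTo K F L)) (sym (sumTo-+ K (F e) (λ i → sumℚ (map (λ e → F e i) L))))

convolve≡sumTo : ∀ f g k → convolve f g k ≡ sumTo (suc k) (λ i → f i ℚ.* g (k ∸ i))
convolve≡sumTo f g k = go (suc k) (λ i → i)
  where
  go : ∀ K (h : ℕ → ℕ) → sumℚ (map (λ i → f i ℚ.* g (k ∸ i)) (applyUpTo h K)) ≡ sumTo K (λ i → f (h i) ℚ.* g (k ∸ h i))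
  go zero h = refl
  go (suc K) h = cong (f (h 0) ℚ.* g (k ∸ h 0) ℚ.+_) (go K (h ∘ suc))

convolve-cong : ∀ {f f′ g g′ : ℕ → ℚ} → (∀ j → f j ≡ f′ j) → (∀ j → g j ≡ g′ j) → ∀ k → convolve f g k ≡ convolve f′ g′ k
convolve-cong f≗f′ g≗g′ k = sumℚ-map-cong (upTo (suc k)) (λ i _ → cong₂ ℚ._*_ (f≗f′ i) (g≗g′ (k ∸ i)))

convolve-sumℚˡ : {A : Set} (G : A → ℕ → ℚ) (H : ℕ → ℚ) (k : ℕ) (L : List A) →
  sumℚ (map (λ e → convolve (G e) H k) L) ≡ convolve (λ j → sumℚ (map (λ e → G e j) L)) H k
convolve-sumℚˡ G H k L = begin
  sumℚ (map (λ e → convolve (G e) H k) L)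
    ≡⟨ sumℚ-map-cong L (λ e _ → convolve≡sumTo (G e) H k) ⟩
  sumℚ (map (λ e → sumTo (suc k) (λ i → G e i ℚ.* H (k ∸ i))) L)
    ≡⟨ sumℚ-map-sumTo (suc k) (λ e i → G e i ℚ.* H (k ∸ i)) L ⟩
  sumTo (suc k) (λ i → sumℚ (map (λ e → G e i ℚ.* H (k ∸ i)) L))
    ≡⟨ sumTo-cong (suc k) (λ i _ → sumℚ-map-*ʳ (H (k ∸ i)) (λ e → G e i) L) ⟩
  sumTo (suc k) (λ i → sumℚ (map (λ e → G e i) L) ℚ.* H (k ∸ i))
    ≡⟨ convolve≡sumTo (λ j → sumℚ (map (λ e → G e j) L)) H k ⟨
  convolve (λ j → sumℚ (map (λ e → G e j) L)) H k
    ∎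
  where open ≡-Reasoning

convolve-sumℚʳ : {A : Set} (G : A → ℕ → ℚ) (H : ℕ → ℚ) (k : ℕ) (L : List A) →
  sumℚ (map (λ e → convolve H (G e) k) L) ≡ convolve H (λ j → sumℚ (map (λ e → G e j) L)) k
convolve-sumℚʳ G H k L = begin
  sumℚ (map (λ e → convolve H (G e) k) L)
    ≡⟨ sumℚ-map-cong L (λ e _ → convolve≡sumTo H (G e) k) ⟩
  sumℚ (map (λ e → sumTo (suc k) (λ i → H i ℚ.* G e (k ∸ i))) L)
    ≡⟨ sumℚ-map-sumTo (suc k) (λ e i → H i ℚ.* G e (k ∸ i)) L ⟩
  sumTo (suc k) (λ i → sumℚ (map (λ e → H i ℚ.* G e (k ∸ i)) L))
    ≡⟨ sumTo-cong (suc k) (λ i _ → sumℚ-map-*ˡ (H i) (λ e → G e (k ∸ i)) L) ⟩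
  sumTo (suc k) (λ i → H i ℚ.* sumℚ (map (λ e → G e (k ∸ i)) L))
    ≡⟨ convolve≡sumTo H (λ j → sumℚ (map (λ e → G e j) L)) k ⟨
  convolve H (λ j → sumℚ (map (λ e → G e j) L)) k
    ∎
  where open ≡-Reasoning

convolve-*ˡ : ∀ c f g k → convolve (λ j → c ℚ.* f j) g k ≡ c ℚ.* convolve f g k
convolve-*ˡ c f g k =
  trans (convolve≡sumTo (λ j → c ℚ.* f j) g k)
  (trans (sumTo-cong (suc k) (λ i _ → ℚP.*-assoc c (f i) (g (k ∸ i))))
  (trans (sumTo-*ˡ (suc k) c (λ i → f i ℚ.* g (k ∸ i))) (cong (c ℚ.*_) (sym (convolve≡sumTo f g k)))))

convolve-*ʳ : ∀ c f g k → convolve f (λ j → c ℚ.* g j) k ≡ c ℚ.* convolve f g k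
convolve-*ʳ c f g k =
  trans (convolve≡sumTo f (λ j → c ℚ.* g j) k)
  (trans (sumTo-cong (suc k) (λ i _ → *-left-comm (f i) c (g (k ∸ i))))
  (trans (sumTo-*ˡ (suc k) c (λ i → f i ℚ.* g (k ∸ i))) (cong (c ℚ.*_) (sym (convolve≡sumTo f g k)))))

-- Coefficients of x^[b] g(x).
mulXIf : Bool → (ℕ → ℚ) → ℕ → ℚ
mulXIf false g k = g k
mulXIf true g zero = 0ℚ
mulXIf true g (suc k) = g k

mulXIf-cong : ∀ b {F G : ℕ → ℚ} → (∀ j → F j ≡ G j) → ∀ k → mulXIf b F k ≡ mulXIf b G k
mulXIf-cong false F≗G k = F≗G k
mulXIf-cong true F≗G zero = refl
mulXIf-cong true F≗G (suc k) = F≗G k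

mulXIf-convolveˡ : ∀ b f g k → mulXIf b (convolve f g) k ≡ convolve (mulXIf b f) g k
mulXIf-convolveˡ false f g k = refl
mulXIf-convolveˡ true f g zero =
  sym (trans (convolve≡sumTo (mulXIf true f) g 0) (trans (cong (ℚ._+ 0ℚ) (ℚP.*-zeroˡ (g 0))) (ℚP.+-identityʳ 0ℚ)))
mulXIf-convolveˡ true f g (suc k) = sym (begin
  convolve (mulXIf true f) g (suc k)                        ≡⟨ convolve≡sumTo (mulXIf true f) g (suc k) ⟩
  0ℚ ℚ.* g (suc k) ℚ.+ sumTo (suc k) (λ i → f i ℚ.* g (k ∸ i)) ≡⟨ cong (ℚ._+ sumTo (suc k) (λ i → f i ℚ.* g (k ∸ i))) (ℚP.*-zeroˡ (g (suc k))) ⟩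
  0ℚ ℚ.+ sumTo (suc k) (λ i → f i ℚ.* g (k ∸ i))             ≡⟨ ℚP.+-identityˡ _ ⟩
  sumTo (suc k) (λ i → f i ℚ.* g (k ∸ i))                     ≡⟨ convolve≡sumTo f g k ⟨
  convolve f g k                                             ∎)
  where open ≡-Reasoning

mulXIf-convolveʳ : ∀ b f g k → mulXIf b (convolve f g) k ≡ convolve f (mulXIf b g) k
mulXIf-convolveʳ false f g k = refl
mulXIf-convolveʳ true f g zero =
  sym (trans (convolve≡sumTo f (mulXIf true g) 0) (trans (cong (ℚ._+ 0ℚ) (ℚP.*-zeroʳ (f 0))) (ℚP.+-identityʳ 0ℚ)))
mulXIf-convolveʳ true f g (suc k) = sym (begin
  convolve f (mulXIf true g) (suc k)
    ≡⟨ convolve≡sumTo f (mulXIf true g) (suc k) ⟩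
  sumTo (suc (suc k)) (λ i → f i ℚ.* mulXIf true g (suc k ∸ i))
    ≡⟨ sumTo-suc (suc k) (λ i → f i ℚ.* mulXIf true g (suc k ∸ i)) ⟩
  sumTo (suc k) (λ i → f i ℚ.* mulXIf true g (suc k ∸ i)) ℚ.+ f (suc k) ℚ.* mulXIf true g (suc k ∸ suc k)
    ≡⟨ cong₂ ℚ._+_ (sumTo-cong (suc k) (λ i i≤k → cong (λ z → f i ℚ.* mulXIf true g z) (ℕP.+-∸-assoc 1 (ℕP.≤-pred i≤k))))
                   (trans (cong (λ z → f (suc k) ℚ.* mulXIf true g z) (ℕP.n∸n≡0 k)) (ℚP.*-zeroʳ (f (suc k)))) ⟩
  sumTo (suc k) (λ i → f i ℚ.* g (k ∸ i)) ℚ.+ 0ℚ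
    ≡⟨ ℚP.+-identityʳ _ ⟩
  sumTo (suc k) (λ i → f i ℚ.* g (k ∸ i))
    ≡⟨ convolve≡sumTo f g k ⟨
  convolve f g k
    ∎)
  where open ≡-Reasoning

⌊≟⌋-suc : ∀ c k → ⌊ suc c ℕ.≟ suc k ⌋ ≡ ⌊ c ℕ.≟ k ⌋
⌊≟⌋-suc c k with c ℕ.≟ k | suc c ℕ.≟ suc k
... | yes _ | yes _ = refl
... | no _ | no _ = refl
... | yes c≡k | no sc≢sk = ⊥-elim (sc≢sk (cong suc c≡k))
... | no c≢k | yes sc≡sk = ⊥-elim (c≢k (ℕP.suc-injective sc≡sk))

module _ {n : ℕ} where

  open Removal {Edge n} (≡-dec FinP._≟_ FinP._≟_)

  isIsolatedEdge : Graph n → Edge n → Bool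
  isIsolatedEdge es e = not (nonIsolated (deleteEdge es e) (proj₁ e)) ∧ not (nonIsolated (deleteEdge es e) (proj₂ e))

  countOrderings : Bool → ℕ → Graph n → ℕ
  countOrderings b k D = sumOrderings (λ σ → [ ⌊ componentCount (buildForest σ) + [ b ]ᵇ ℕ.≟ k ⌋ ]ᵇ) D

  pCoeff≡divℕ : ∀ (es : Graph n) k f → length es ! ≡ suc f → pCoeff n es k ≡ divℕ (countOrderings false k es) (suc f)
  pCoeff≡divℕ es k f es!≡ =
    cong₂ divℕ (trans (length-filter≡sumBy _ (orderings es))
                      (sumOrderings-cong es (λ σ → cong (λ c → [ ⌊ c ℕ.≟ k ⌋ ]ᵇ) (sym (ℕP.+-identityʳ _)))))
               (trans (length-orderings es) es!≡)

  mulXIf-pCoeff : ∀ b (D : Graph n) k f → length D ! ≡ suc f → mulXIf b (pCoeff n D) k ≡ divℕ (countOrderings b k D) (suc f)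
  mulXIf-pCoeff false D k f D!≡ = pCoeff≡divℕ D k f D!≡
  mulXIf-pCoeff true D zero f D!≡ = begin
    0ℚ                                   ≡⟨ divℕ-0 f ⟨
    divℕ 0 (suc f)                       ≡⟨ cong (λ z → divℕ z (suc f)) none ⟨
    divℕ (countOrderings true 0 D) (suc f) ∎
    where
    open ≡-Reasoning
    none : countOrderings true 0 D ≡ 0
    none = trans (sumOrderings-cong D (λ σ → cong (λ c → [ ⌊ c ℕ.≟ 0 ⌋ ]ᵇ) (ℕP.+-comm _ 1)))
                 (trans (sumBy-const 0 (orderings D)) (ℕP.*-zeroʳ (length (orderings D))))
  mulXIf-pCoeff true D (suc k) f D!≡ = trans (pCoeff≡divℕ D k f D!≡) (cong (λ z → divℕ z (suc f)) shift)
    where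
    shift : countOrderings false k D ≡ countOrderings true (suc k) D
    shift = sumOrderings-cong D (λ σ → cong [_]ᵇ (trans (sym (⌊≟⌋-suc (componentCount (buildForest σ) + 0) k))
                                                          (cong (λ c → ⌊ c ℕ.≟ suc k ⌋) (trans (cong suc (ℕP.+-identityʳ _)) (ℕP.+-comm 1 _)))))

  countOrderings-by-last : ∀ x xs → Simple n (x ∷ xs) → ∀ k →
    countOrderings false k (x ∷ xs) ≡
      sumBy (λ e → countOrderings (isIsolatedEdge (x ∷ xs) e) k (deleteEdge (x ∷ xs) e)) (x ∷ xs)
  countOrderings-by-last x xs (ordered , unique) k =
    trans (sumOrderings-by-last x xs unique _) (sumBy-cong (x ∷ xs) last-edge)
    where
    last-edge : ∀ e → e ∈ x ∷ xs →
      sumOrderings (λ τ → [ ⌊ componentCount (buildForest (τ ∷ʳ e)) + 0 ℕ.≟ k ⌋ ]ᵇ) (deleteEdge (x ∷ xs) e) ≡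
        countOrderings (isIsolatedEdge (x ∷ xs) e) k (deleteEdge (x ∷ xs) e)
    last-edge (a , b) e∈ = sumBy-cong (orderings D) (λ τ τ∈ →
        cong (λ c → [ ⌊ c ℕ.≟ k ⌋ ]ᵇ)
             (trans (ℕP.+-identityʳ _)
                    (componentCount-buildForest-∷ʳ D τ (nonIsolated-↭ (∈-orderings⇒↭ D τ τ∈)) a b (All.lookup ordered e∈))))
      where
      D : Graph n
      D = deleteEdge (x ∷ xs) (a , b)

  pCoeff-recurrence : ∀ (es : Graph n) → Simple n es → 0 ℕ.< length es → ∀ k →
    pCoeff n es k ≡ average (map (λ e → mulXIf (isIsolatedEdge es e) (pCoeff n (deleteEdge es e)) k) es)
  pCoeff-recurrence es@(x ∷ xs) simple@(_ , unique) _ k = begin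
    pCoeff n es k
      ≡⟨ pCoeff≡divℕ es k (f + t * suc f) (cong (suc t *_) t!≡) ⟩
    divℕ (countOrderings false k es) (suc t * suc f)
      ≡⟨ cong (λ c → divℕ c (suc t * suc f)) (trans (countOrderings-by-last x xs simple k) (sym (ℕP.*-identityˡ _))) ⟩
    divℕ (1 * sumBy lastCount es) (suc t * suc f)
      ≡⟨ divℕ-* 1 (sumBy lastCount es) t f ⟨
    divℕ 1 (suc t) ℚ.* divℕ (sumBy lastCount es) (suc f)
      ≡⟨ cong (divℕ 1 (suc t) ℚ.*_) (sumℚ-map-divℕ lastCount f es) ⟨
    divℕ 1 (suc t) ℚ.* sumℚ (map (λ e → divℕ (lastCount e) (suc f)) es)
      ≡⟨ cong (divℕ 1 (suc t) ℚ.*_) (sumℚ-map-cong es (λ e e∈ → sym (mulXIf-pCoeff (isIsolatedEdge es e) (deleteEdge es e) k f (D!≡ e e∈)))) ⟩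
    divℕ 1 (suc t) ℚ.* sumℚ (map term es)
      ≡⟨ average≡ term es t refl ⟨
    average (map term es)
      ∎
    where
    open ≡-Reasoning
    t f : ℕ
    t = length xs
    f = ℕ.pred (t !)
    t!≡ : t ! ≡ suc f
    t!≡ = sym (ℕP.suc-pred (t !) {{t ℕP.!≢0}})
    lastCount : Edge n → ℕ
    lastCount e = countOrderings (isIsolatedEdge es e) k (deleteEdge es e)
    term : Edge n → ℚ
    term e = mulXIf (isIsolatedEdge es e) (pCoeff n (deleteEdge es e)) k
    D!≡ : ∀ e → e ∈ es → length (deleteEdge es e) ! ≡ suc f
    D!≡ e e∈ = trans (cong _! (ℕP.suc-injective (sym (length-remove es unique e∈)))) t!≡

  sumℚ-recurrence : ∀ (es : Graph n) → Simple n es → ∀ k →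
    sumℚ (map (λ e → mulXIf (isIsolatedEdge es e) (pCoeff n (deleteEdge es e)) k) es) ≡ divℕ (length es) 1 ℚ.* pCoeff n es k
  sumℚ-recurrence [] _ k = sym (trans (cong (ℚ._* pCoeff n [] k) (divℕ-0 0)) (ℚP.*-zeroˡ (pCoeff n [] k)))
  sumℚ-recurrence es@(x ∷ xs) simple k = sym (begin
    divℕ (suc t) 1 ℚ.* pCoeff n es k                                ≡⟨ cong (divℕ (suc t) 1 ℚ.*_) (pCoeff-recurrence es simple (s≤s z≤n) k) ⟩
    divℕ (suc t) 1 ℚ.* average (map term es)                        ≡⟨ cong (divℕ (suc t) 1 ℚ.*_) (average≡ term es t refl) ⟩
    divℕ (suc t) 1 ℚ.* (divℕ 1 (suc t) ℚ.* sumℚ (map term es))      ≡⟨ divℕ-cancelʳ t _ ⟩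
    sumℚ (map term es)                                              ∎)
    where
    open ≡-Reasoning
    t : ℕ
    t = length xs
    term : Edge n → ℚ
    term e = mulXIf (isIsolatedEdge es e) (pCoeff n (deleteEdge es e)) k

  length-filter-none : (p : Edge n → Bool) (L : Graph n) → any p L ≡ false → length (filter (λ f → p f BoolP.≟ true) L) ≡ 0
  length-filter-none p [] _ = refl
  length-filter-none p (x ∷ L) none with p x
  ... | false = length-filter-none p L none

  degree≡1 : ∀ (es : Graph n) e → Unique es → e ∈ es → ∀ x → x ≡ proj₁ e ⊎ x ≡ proj₂ e →
    nonIsolated (deleteEdge es e) x ≡ false → degree es x ≡ 1
  degree≡1 es e unique e∈ x x∈e x-iso = begin
    degree es x                                           ≡⟨ length-filter-remove (λ f → incident f BoolP.≟ true) es unique e∈ ⟩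
    length (filter (λ f → incident f BoolP.≟ true) (deleteEdge es e)) + [ ⌊ incident e BoolP.≟ true ⌋ ]ᵇ
                                                          ≡⟨ cong₂ _+_ (length-filter-none incident (deleteEdge es e) x-iso) e-incident ⟩
    1                                                     ∎
    where
    open ≡-Reasoning
    incident : Edge n → Bool
    incident f = eqV (proj₁ f) x ∨ eqV (proj₂ f) x
    incident-e : x ≡ proj₁ e ⊎ x ≡ proj₂ e → incident e ≡ true
    incident-e (inj₁ refl) = ∨-trueˡ _ (eqV-refl x)
    incident-e (inj₂ refl) = ∨-trueʳ (eqV (proj₁ e) x) (eqV-refl x)
    e-incident : [ ⌊ incident e BoolP.≟ true ⌋ ]ᵇ ≡ 1
    e-incident rewrite incident-e x∈e = refl

  isIsolatedEdge-false : ∀ (es : Graph n) → Simple n es → NoIsolatedEdge n es → ∀ e → e ∈ es → isIsolatedEdge es e ≡ false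
  isIsolatedEdge-false es (_ , unique) no-isolated e e∈
    with nonIsolated (deleteEdge es e) (proj₁ e) in u-cov | nonIsolated (deleteEdge es e) (proj₂ e) in v-cov
  ... | true | _ = refl
  ... | false | true = refl
  ... | false | false = ⊥-elim (All.lookup no-isolated e∈ (degree≡1 es e unique e∈ (proj₁ e) (inj₁ refl) u-cov ,
                                                        degree≡1 es e unique e∈ (proj₂ e) (inj₂ refl) v-cov))

  pCoeff-recurrence-noIsolatedEdge : ∀ (es : Graph n) → Simple n es → 0 ℕ.< length es → NoIsolatedEdge n es → ∀ k →
    pCoeff n es k ≡ average (map (λ e → pCoeff n (deleteEdge es e) k) es)
  pCoeff-recurrence-noIsolatedEdge es simple nonempty no-isolated k =
    trans (pCoeff-recurrence es simple nonempty k)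
          (cong average (map-cong-local (All.tabulate (λ {e} e∈ →
            cong (λ b → mulXIf b (pCoeff n (deleteEdge es e)) k) (isIsolatedEdge-false es simple no-isolated e e∈)))))

mapEdge : ∀ {n m} → (Fin n → Fin m) → Edge n → Edge m
mapEdge φ e = (φ (proj₁ e) , φ (proj₂ e))

module _ {n m : ℕ} (φ : Fin n → Fin m) (φ-injective : ∀ {a b} → φ a ≡ φ b → a ≡ b) where

  mapEdge-injective : ∀ {g h} → mapEdge φ g ≡ mapEdge φ h → g ≡ h
  mapEdge-injective eq = ×-≡,≡→≡ (φ-injective (cong proj₁ eq) , φ-injective (cong proj₂ eq))

  deleteEdge-map : ∀ (es : Graph n) g → deleteEdge (map (mapEdge φ) es) (mapEdge φ g) ≡ map (mapEdge φ) (deleteEdge es g)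
  deleteEdge-map [] g = refl
  deleteEdge-map (h ∷ es) g with ≡-dec FinP._≟_ FinP._≟_ (mapEdge φ h) (mapEdge φ g) | ≡-dec FinP._≟_ FinP._≟_ h g
  ... | yes _ | yes _ = deleteEdge-map es g
  ... | no _ | no _ = cong (mapEdge φ h ∷_) (deleteEdge-map es g)
  ... | yes φh≡φg | no h≢g = ⊥-elim (h≢g (mapEdge-injective φh≡φg))
  ... | no φh≢φg | yes refl = ⊥-elim (φh≢φg refl)

  eqV-map : ∀ a b → eqV (φ a) (φ b) ≡ eqV a b
  eqV-map a b with φ a FinP.≟ φ b | a FinP.≟ b
  ... | yes _ | yes _ = refl
  ... | no _ | no _ = refl
  ... | yes φa≡φb | no a≢b = ⊥-elim (a≢b (φ-injective φa≡φb))
  ... | no φa≢φb | yes refl = ⊥-elim (φa≢φb refl)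

  nonIsolated-map : ∀ (es : Graph n) u → nonIsolated (map (mapEdge φ) es) (φ u) ≡ nonIsolated es u
  nonIsolated-map es u =
    trans (any-map _ (mapEdge φ) es) (any-cong es (λ e → cong₂ _∨_ (eqV-map (proj₁ e) u) (eqV-map (proj₂ e) u)))

nonIsolated-map-∉ : ∀ {n m} (φ : Fin n → Fin m) (es : Graph n) w → (∀ a → ¬ φ a ≡ w) →
  nonIsolated (map (mapEdge φ) es) w ≡ false
nonIsolated-map-∉ φ es w w∉ = any-false⁺ _ (map (mapEdge φ) es) λ e e∈ incident → case-incident e e∈ incident
  where
  case-incident : ∀ e → e ∈ map (mapEdge φ) es → (eqV (proj₁ e) w ∨ eqV (proj₂ e) w) ≡ true → ⊥
  case-incident e e∈ incident with ∈-map⁻ (mapEdge φ) e∈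
  ... | g , _ , refl with ∨-true⁻ {eqV (φ (proj₁ g)) w} incident
  ... | inj₁ p≡w = w∉ (proj₁ g) (eqV⇒≡ p≡w)
  ... | inj₂ q≡w = w∉ (proj₂ g) (eqV⇒≡ q≡w)

deleteEdge-∉ : ∀ {n} (es : Graph n) e → e ∉ es → deleteEdge es e ≡ es
deleteEdge-∉ es e = Removal.remove-∉ (≡-dec FinP._≟_ FinP._≟_) es

length-deleteEdge : ∀ {n} (es : Graph n) {e} → Unique es → e ∈ es → length es ≡ suc (length (deleteEdge es e))
length-deleteEdge es = Removal.length-remove (≡-dec FinP._≟_ FinP._≟_) es

simple-deleteEdge : ∀ {n} (es : Graph n) e → Simple n es → Simple n (deleteEdge es e)
simple-deleteEdge es e (ordered , unique) =
  AllP.filter⁺ (λ f → ¬? (≡-dec FinP._≟_ FinP._≟_ f e)) ordered , Removal.unique-remove (≡-dec FinP._≟_ FinP._≟_) es unique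

module DisjointUnion (n m : ℕ) where

  inl : Fin n → Fin (n + m)
  inl a = a ↑ˡ m

  inr : Fin m → Fin (n + m)
  inr b = n ↑ʳ b

  inl≢inr : ∀ a b → ¬ inl a ≡ inr b
  inl≢inr a b eq = ℕP.m+n≮m n (toℕ b)
    (subst (ℕ._< n) (trans (sym (FinP.toℕ-↑ˡ a m)) (trans (cong toℕ eq) (FinP.toℕ-↑ʳ n b))) (FinP.toℕ<n a))

  inl-injective : ∀ {a b} → inl a ≡ inl b → a ≡ b
  inl-injective = FinP.↑ˡ-injective m _ _

  inr-injective : ∀ {a b} → inr a ≡ inr b → a ≡ b
  inr-injective = FinP.↑ʳ-injective n _ _

  inlE∉inrE : ∀ (fs : Graph m) g → mapEdge inl g ∉ map (mapEdge inr) fs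
  inlE∉inrE fs g g∈ with ∈-map⁻ (mapEdge inr) g∈
  ... | f , _ , eq = inl≢inr (proj₁ g) (proj₁ f) (cong proj₁ eq)

  inrE∉inlE : ∀ (es : Graph n) f → mapEdge inr f ∉ map (mapEdge inl) es
  inrE∉inlE es f f∈ with ∈-map⁻ (mapEdge inl) f∈
  ... | g , _ , eq = inl≢inr (proj₁ g) (proj₁ f) (sym (cong proj₁ eq))

  deleteEdge-++ : ∀ {k} (es fs : Graph k) e → deleteEdge (es ++ fs) e ≡ deleteEdge es e ++ deleteEdge fs e
  deleteEdge-++ es fs e = filter-++ (λ f → ¬? (≡-dec FinP._≟_ FinP._≟_ f e)) es fs

  deleteEdge-inl : ∀ es fs g → deleteEdge (disjointUnion es fs) (mapEdge inl g) ≡ disjointUnion (deleteEdge es g) fs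
  deleteEdge-inl es fs g = trans (deleteEdge-++ (map (mapEdge inl) es) _ _)
    (cong₂ _++_ (deleteEdge-map inl inl-injective es g) (deleteEdge-∉ (map (mapEdge inr) fs) _ (inlE∉inrE fs g)))

  deleteEdge-inr : ∀ es fs f → deleteEdge (disjointUnion es fs) (mapEdge inr f) ≡ disjointUnion es (deleteEdge fs f)
  deleteEdge-inr es fs f = trans (deleteEdge-++ (map (mapEdge inl) es) _ _)
    (cong₂ _++_ (deleteEdge-∉ (map (mapEdge inl) es) _ (inrE∉inlE es f)) (deleteEdge-map inr inr-injective fs f))

  nonIsolated-inl : ∀ es fs u → nonIsolated (disjointUnion es fs) (inl u) ≡ nonIsolated es u
  nonIsolated-inl es fs u = begin
    nonIsolated (disjointUnion es fs) (inl u)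
      ≡⟨ nonIsolated-++ (map (mapEdge inl) es) _ (inl u) ⟩
    nonIsolated (map (mapEdge inl) es) (inl u) ∨ nonIsolated (map (mapEdge inr) fs) (inl u)
      ≡⟨ cong₂ _∨_ (nonIsolated-map inl inl-injective es u) (nonIsolated-map-∉ inr fs (inl u) (λ b eq → inl≢inr u b (sym eq))) ⟩
    nonIsolated es u ∨ false
      ≡⟨ BoolP.∨-identityʳ _ ⟩
    nonIsolated es u
      ∎
    where open ≡-Reasoning

  nonIsolated-inr : ∀ es fs u → nonIsolated (disjointUnion es fs) (inr u) ≡ nonIsolated fs u
  nonIsolated-inr es fs u =
    trans (nonIsolated-++ (map (mapEdge inl) es) _ (inr u))
          (cong₂ _∨_ (nonIsolated-map-∉ inl es (inr u) (λ a → inl≢inr a u)) (nonIsolated-map inr inr-injective fs u))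

  isIsolatedEdge-inl : ∀ es fs g → isIsolatedEdge (disjointUnion es fs) (mapEdge inl g) ≡ isIsolatedEdge es g
  isIsolatedEdge-inl es fs g = cong₂ (λ p q → not p ∧ not q) (endpoint (proj₁ g)) (endpoint (proj₂ g))
    where
    endpoint : ∀ u → nonIsolated (deleteEdge (disjointUnion es fs) (mapEdge inl g)) (inl u) ≡ nonIsolated (deleteEdge es g) u
    endpoint u = trans (cong (λ D → nonIsolated D (inl u)) (deleteEdge-inl es fs g)) (nonIsolated-inl (deleteEdge es g) fs u)

  isIsolatedEdge-inr : ∀ es fs f → isIsolatedEdge (disjointUnion es fs) (mapEdge inr f) ≡ isIsolatedEdge fs f
  isIsolatedEdge-inr es fs f = cong₂ (λ p q → not p ∧ not q) (endpoint (proj₁ f)) (endpoint (proj₂ f))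
    where
    endpoint : ∀ u → nonIsolated (deleteEdge (disjointUnion es fs) (mapEdge inr f)) (inr u) ≡ nonIsolated (deleteEdge fs f) u
    endpoint u = trans (cong (λ D → nonIsolated D (inr u)) (deleteEdge-inr es fs f)) (nonIsolated-inr es (deleteEdge fs f) u)

  simple-disjointUnion : ∀ es fs → Simple n es → Simple m fs → Simple (n + m) (disjointUnion es fs)
  simple-disjointUnion es fs (es-ordered , es-unique) (fs-ordered , fs-unique) =
    AllP.++⁺ (AllP.map⁺ (All.map (λ {e} u<v → subst₂ ℕ._<_ (sym (FinP.toℕ-↑ˡ (proj₁ e) m)) (sym (FinP.toℕ-↑ˡ (proj₂ e) m)) u<v) es-ordered))
             (AllP.map⁺ (All.map (λ {e} u<v → subst₂ ℕ._<_ (sym (FinP.toℕ-↑ʳ n (proj₁ e))) (sym (FinP.toℕ-↑ʳ n (proj₂ e)))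
                                                        (ℕP.+-monoʳ-< n u<v)) fs-ordered))
    , UniqueP.++⁺ (UniqueP.map⁺ (mapEdge-injective inl inl-injective) es-unique)
                  (UniqueP.map⁺ (mapEdge-injective inr inr-injective) fs-unique)
                  (λ (in-es , in-fs) → disjoint in-es in-fs)
    where
    disjoint : ∀ {v} → v ∈ map (mapEdge inl) es → ¬ v ∈ map (mapEdge inr) fs
    disjoint v∈ with ∈-map⁻ (mapEdge inl) v∈
    ... | g , _ , refl = inlE∉inrE fs g

  length-disjointUnion : ∀ es fs → length (disjointUnion es fs) ≡ length es + length fs
  length-disjointUnion es fs = trans (length-++ (map (mapEdge inl) es)) (cong₂ _+_ (length-map _ es) (length-map _ fs))

componentCount-[] : ∀ {n} → componentCount {n} [] ≡ 0
componentCount-[] {n} = trans (componentCount≡count {n} []) (trans (count-cong {n} (λ _ → refl)) (count-false {n}))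

pCoeff-[]-zero : ∀ n → pCoeff n [] 0 ≡ 1ℚ
pCoeff-[]-zero n = trans (pCoeff≡divℕ {n} [] 0 0 refl) (cong (λ c → divℕ ([ ⌊ c + 0 ℕ.≟ 0 ⌋ ]ᵇ + 0) 1) (componentCount-[] {n}))

pCoeff-[]-suc : ∀ n k → pCoeff n [] (suc k) ≡ 0ℚ
pCoeff-[]-suc n k = trans (pCoeff≡divℕ {n} [] (suc k) 0 refl) (cong (λ c → divℕ ([ ⌊ c + 0 ℕ.≟ suc k ⌋ ]ᵇ + 0) 1) (componentCount-[] {n}))

pCoeff-disjointUnion-[] : ∀ n m k → pCoeff (n + m) (disjointUnion {n} {m} [] []) k ≡ convolve (pCoeff n []) (pCoeff m []) k
pCoeff-disjointUnion-[] n m zero = begin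
  pCoeff (n + m) [] 0                                   ≡⟨ pCoeff-[]-zero (n + m) ⟩
  1ℚ                                                    ≡⟨ ℚP.*-identityˡ 1ℚ ⟨
  1ℚ ℚ.* 1ℚ                                             ≡⟨ ℚP.+-identityʳ _ ⟨
  1ℚ ℚ.* 1ℚ ℚ.+ 0ℚ                                      ≡⟨ cong (λ x → x ℚ.+ 0ℚ) (cong₂ ℚ._*_ (pCoeff-[]-zero n) (pCoeff-[]-zero m)) ⟨
  convolve (pCoeff n []) (pCoeff m []) 0                ∎
  where open ≡-Reasoning
pCoeff-disjointUnion-[] n m (suc k) = begin
  pCoeff (n + m) [] (suc k)                              ≡⟨ pCoeff-[]-suc (n + m) k ⟩
  0ℚ                                                     ≡⟨ sumTo-0 (suc (suc k)) _ vanishes ⟨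
  sumTo (suc (suc k)) (λ i → pCoeff n [] i ℚ.* pCoeff m [] (suc k ∸ i)) ≡⟨ convolve≡sumTo (pCoeff n []) (pCoeff m []) (suc k) ⟨
  convolve (pCoeff n []) (pCoeff m []) (suc k)           ∎
  where
  open ≡-Reasoning
  vanishes : ∀ i → pCoeff n [] i ℚ.* pCoeff m [] (suc k ∸ i) ≡ 0ℚ
  vanishes zero = trans (cong (pCoeff n [] 0 ℚ.*_) (pCoeff-[]-suc m k)) (ℚP.*-zeroʳ (pCoeff n [] 0))
  vanishes (suc j) = trans (cong (ℚ._* pCoeff m [] (k ∸ j)) (pCoeff-[]-suc n j)) (ℚP.*-zeroˡ (pCoeff m [] (k ∸ j)))

pCoeff-disjointUnion : ∀ s n m (es : Graph n) (fs : Graph m) → length es + length fs ≡ s → Simple n es → Simple m fs → ∀ k →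
  pCoeff (n + m) (disjointUnion es fs) k ≡ convolve (pCoeff n es) (pCoeff m fs) k
pCoeff-disjointUnion zero n m [] [] _ _ _ k = pCoeff-disjointUnion-[] n m k
pCoeff-disjointUnion (suc s) n m es fs size es-simple@(_ , es-unique) fs-simple@(_ , fs-unique) k = begin
  pCoeff (n + m) U k                             ≡⟨ pCoeff-recurrence U U-simple (subst (0 ℕ.<_) (sym U-size) (s≤s z≤n)) k ⟩
  average (map term U)                           ≡⟨ average≡ term U s U-size ⟩
  divℕ 1 (suc s) ℚ.* sumℚ (map term U)           ≡⟨ cong (divℕ 1 (suc s) ℚ.*_) term-total ⟩
  divℕ 1 (suc s) ℚ.* (divℕ (suc s) 1 ℚ.* C)      ≡⟨ divℕ-cancelˡ s C ⟩
  C                                              ∎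
  where
  open ≡-Reasoning
  open DisjointUnion n m
  U : Graph (n + m)
  U = disjointUnion es fs
  U-simple : Simple (n + m) U
  U-simple = simple-disjointUnion es fs es-simple fs-simple
  U-size : length U ≡ suc s
  U-size = trans (length-disjointUnion es fs) size
  C : ℚ
  C = convolve (pCoeff n es) (pCoeff m fs) k
  term : Edge (n + m) → ℚ
  term e = mulXIf (isIsolatedEdge U e) (pCoeff (n + m) (deleteEdge U e)) k
  termˡ : Edge n → ℕ → ℚ
  termˡ g = mulXIf (isIsolatedEdge es g) (pCoeff n (deleteEdge es g))
  termʳ : Edge m → ℕ → ℚ
  termʳ f = mulXIf (isIsolatedEdge fs f) (pCoeff m (deleteEdge fs f))

  term-inl : ∀ g → g ∈ es → term (mapEdge inl g) ≡ convolve (termˡ g) (pCoeff m fs) k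
  term-inl g g∈ = begin
    term (mapEdge inl g)
      ≡⟨ cong₂ (λ b D → mulXIf b (pCoeff (n + m) D) k) (isIsolatedEdge-inl es fs g) (deleteEdge-inl es fs g) ⟩
    mulXIf (isIsolatedEdge es g) (pCoeff (n + m) (disjointUnion (deleteEdge es g) fs)) k
      ≡⟨ mulXIf-cong (isIsolatedEdge es g) (pCoeff-disjointUnion s n m (deleteEdge es g) fs smaller
                                              (simple-deleteEdge es g es-simple) fs-simple) k ⟩
    mulXIf (isIsolatedEdge es g) (convolve (pCoeff n (deleteEdge es g)) (pCoeff m fs)) k
      ≡⟨ mulXIf-convolveˡ (isIsolatedEdge es g) (pCoeff n (deleteEdge es g)) (pCoeff m fs) k ⟩
    convolve (termˡ g) (pCoeff m fs) k
      ∎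
    where
    smaller : length (deleteEdge es g) + length fs ≡ s
    smaller = ℕP.suc-injective (trans (cong (_+ length fs) (sym (length-deleteEdge es es-unique g∈))) size)

  term-inr : ∀ f → f ∈ fs → term (mapEdge inr f) ≡ convolve (pCoeff n es) (termʳ f) k
  term-inr f f∈ = begin
    term (mapEdge inr f)
      ≡⟨ cong₂ (λ b D → mulXIf b (pCoeff (n + m) D) k) (isIsolatedEdge-inr es fs f) (deleteEdge-inr es fs f) ⟩
    mulXIf (isIsolatedEdge fs f) (pCoeff (n + m) (disjointUnion es (deleteEdge fs f))) k
      ≡⟨ mulXIf-cong (isIsolatedEdge fs f) (pCoeff-disjointUnion s n m es (deleteEdge fs f) smaller
                                              es-simple (simple-deleteEdge fs f fs-simple)) k ⟩
    mulXIf (isIsolatedEdge fs f) (convolve (pCoeff n es) (pCoeff m (deleteEdge fs f))) k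
      ≡⟨ mulXIf-convolveʳ (isIsolatedEdge fs f) (pCoeff n es) (pCoeff m (deleteEdge fs f)) k ⟩
    convolve (pCoeff n es) (termʳ f) k
      ∎
    where
    smaller : length es + length (deleteEdge fs f) ≡ s
    smaller = ℕP.suc-injective (trans (sym (ℕP.+-suc (length es) _))
                (trans (cong (length es +_) (sym (length-deleteEdge fs fs-unique f∈))) size))

  sum-inl : sumℚ (map (term ∘ mapEdge inl) es) ≡ divℕ (length es) 1 ℚ.* C
  sum-inl = begin
    sumℚ (map (term ∘ mapEdge inl) es)
      ≡⟨ sumℚ-map-cong es term-inl ⟩
    sumℚ (map (λ g → convolve (termˡ g) (pCoeff m fs) k) es)
      ≡⟨ convolve-sumℚˡ termˡ (pCoeff m fs) k es ⟩
    convolve (λ j → sumℚ (map (λ g → termˡ g j) es)) (pCoeff m fs) k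
      ≡⟨ convolve-cong (λ j → sumℚ-recurrence es es-simple j) (λ j → refl {x = pCoeff m fs j}) k ⟩
    convolve (λ j → divℕ (length es) 1 ℚ.* pCoeff n es j) (pCoeff m fs) k
      ≡⟨ convolve-*ˡ (divℕ (length es) 1) (pCoeff n es) (pCoeff m fs) k ⟩
    divℕ (length es) 1 ℚ.* C
      ∎

  sum-inr : sumℚ (map (term ∘ mapEdge inr) fs) ≡ divℕ (length fs) 1 ℚ.* C
  sum-inr = begin
    sumℚ (map (term ∘ mapEdge inr) fs)
      ≡⟨ sumℚ-map-cong fs term-inr ⟩
    sumℚ (map (λ f → convolve (pCoeff n es) (termʳ f) k) fs)
      ≡⟨ convolve-sumℚʳ termʳ (pCoeff n es) k fs ⟩
    convolve (pCoeff n es) (λ j → sumℚ (map (λ f → termʳ f j) fs)) k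
      ≡⟨ convolve-cong (λ j → refl {x = pCoeff n es j}) (λ j → sumℚ-recurrence fs fs-simple j) k ⟩
    convolve (pCoeff n es) (λ j → divℕ (length fs) 1 ℚ.* pCoeff m fs j) k
      ≡⟨ convolve-*ʳ (divℕ (length fs) 1) (pCoeff n es) (pCoeff m fs) k ⟩
    divℕ (length fs) 1 ℚ.* C
      ∎

  term-total : sumℚ (map term U) ≡ divℕ (suc s) 1 ℚ.* C
  term-total = begin
    sumℚ (map term U)
      ≡⟨ sumℚ-map-++ term (map (mapEdge inl) es) (map (mapEdge inr) fs) ⟩
    sumℚ (map term (map (mapEdge inl) es)) ℚ.+ sumℚ (map term (map (mapEdge inr) fs))
      ≡⟨ cong₂ ℚ._+_ (trans (sumℚ-map-∘ term (mapEdge inl) es) sum-inl) (trans (sumℚ-map-∘ term (mapEdge inr) fs) sum-inr) ⟩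
    divℕ (length es) 1 ℚ.* C ℚ.+ divℕ (length fs) 1 ℚ.* C
      ≡⟨ ℚP.*-distribʳ-+ C (divℕ (length es) 1) (divℕ (length fs) 1) ⟨
    (divℕ (length es) 1 ℚ.+ divℕ (length fs) 1) ℚ.* C
      ≡⟨ cong (ℚ._* C) (trans (divℕ-+-same (length es) (length fs) 0) (cong (λ z → divℕ z 1) size)) ⟩
    divℕ (suc s) 1 ℚ.* C
      ∎

theorem7 :
    ((n m : ℕ) (es : List (Edge n)) (fs : List (Edge m)) →
      Simple n es → Simple m fs →
      (k : ℕ) → pCoeff (n + m) (disjointUnion es fs) k ≡ convolve (pCoeff n es) (pCoeff m fs) k)
    ×
    ((n : ℕ) (es : List (Edge n)) →
      Simple n es → 0 ℕ.< length es → NoIsolatedEdge n es →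
      (k : ℕ) → pCoeff n es k ≡ average (map (λ e → pCoeff n (deleteEdge es e) k) es))
theorem7 =
  (λ n m es fs → pCoeff-disjointUnion (length es + length fs) n m es fs refl) ,
  (λ n → pCoeff-recurrence-noIsolatedEdge {n})
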